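{- Let $w \in W = W(\widetilde A_{n-1})$. The following are equivalent: (i) $w$ is fully commutative (considering $W$ as a Coxeter group); (ii) if $a, b \in \mathbb{Z}$ with $a < b$ and we have $w(a) > w(b)$, then $w(a) > a$ and $w(b) < b$; (iii) $w$ is $321$-avoiding (considering $W$ as a George group); (iv) there are no positive roots $\alpha, \beta, \alpha + \beta$ in the root system of type $\widetilde A_{n-1}$ such that $w(\alpha) < 0$ and $w(\beta) < 0$.
   Context: Let $n \geq 3$ and let $W$ be the affine Weyl group of type $\widetilde A_{n-1}$, with Coxeter generators $s_1, \ldots, s_n$ (indices modulo $n$, $s_i s_j s_i = s_j s_i s_j$ for adjacent $i,j$ in the cyclic Dynkin diagram, $s_i s_j = s_j s_i$ otherwise). It is realized as the group of permutations $w$ of $\mathbb{Z}$ with $w(i+n) = w(i)+n$ and $\sum_{t=1}^n w(t) = \sum_{t=1}^n t$, where $s_i$ sends $t \mapsto t+1$ if $t \equiv i \mod n$, $t \mapsto t-1$ if $t \equiv i+1 \mod n$, and fixes $t$ otherwise. An element $w$ is fully commutative if no reduced expression for $w$ contains a subword $s_i s_j s_i$; it is $321$-avoiding if there are no integers $a < b < c$ with $w(a) > w(b) > w(c)$. -}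

module Defs where

open import Data.Nat as ℕ using (ℕ; zero; suc; NonZero)
open import Data.Integer as ℤ using (ℤ; +_; _+_; _-_; -_; _*_; _<_; _>_; _%ℕ_; _/ℕ_; 0ℤ; 1ℤ)
open import Data.Fin as Fin using (Fin; toℕ)
open import Data.List using (List; []; _∷_; _++_; length)
open import Data.Product using (Σ; ∃; _×_; _,_; proj₁; proj₂)
open import Data.Sum using (_⊎_)
open import Relation.Nullary using (¬_; does)
open import Data.Bool using (if_then_else_)
open import Relation.Binary.PropositionalEquality using (_≡_; _≢_)
open import Function using (_∘_; id)

sumℤ : ∀ {n} → (Fin n → ℤ) → ℤ
sumℤ {zero}  f = 0ℤ
sumℤ {suc n} f = f Fin.zero + sumℤ (f ∘ Fin.suc)

module _ (n : ℕ) .{{_ : NonZero n}} where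

  -- The group W(Ã_{n-1}) realized as affine permutations of ℤ.

  record AffPerm : Set where
    field
      fun      : ℤ → ℤ
      injective  : ∀ a b → fun a ≡ fun b → a ≡ b
      surjective : ∀ c → ∃ λ a → fun a ≡ c
      periodic : ∀ t → fun (t + + n) ≡ fun t + + n
      sumCond  : sumℤ (λ (t : Fin n) → fun (+ suc (toℕ t))) ≡ sumℤ (λ (t : Fin n) → + suc (toℕ t))

  -- The Coxeter generator s_i (index i ∈ ℤ, read modulo n), as a map ℤ → ℤ.
  sgen : ℤ → ℤ → ℤ
  sgen i t =
    if does (((t - i) %ℕ n) ℕ.≟ 0) then t + 1ℤ
    else if does (((t - (i + 1ℤ)) %ℕ n) ℕ.≟ 0) then t - 1ℤ
    else t

  -- Words in the generators: the letter k : Fin n stands for s_{k+1},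
  -- so the alphabet is s_1, …, s_n.
  Word : Set
  Word = List (Fin n)

  gen : Fin n → ℤ → ℤ
  gen k = sgen (+ suc (toℕ k))

  eval : Word → ℤ → ℤ
  eval []      = id
  eval (k ∷ l) = gen k ∘ eval l

  Expresses : AffPerm → Word → Set
  Expresses w l = ∀ t → eval l t ≡ AffPerm.fun w t

  Reduced : AffPerm → Word → Set
  Reduced w l = Expresses w l × (∀ l′ → Expresses w l′ → length l ℕ.≤ length l′)

  ContainsBraid : Word → Set
  ContainsBraid l = ∃ λ (pre : Word) → ∃ λ (suf : Word) → ∃ λ (i : Fin n) → ∃ λ (j : Fin n) →
                      l ≡ pre ++ (i ∷ j ∷ i ∷ suf)

  FullyCommutative : AffPerm → Set
  FullyCommutative w = ∀ l → Reduced w l → ¬ ContainsBraid l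

  CondII : AffPerm → Set
  CondII w = ∀ a b → a < b → AffPerm.fun w a > AffPerm.fun w b →
               (AffPerm.fun w a > a) × (AffPerm.fun w b < b)

  Avoids321 : AffPerm → Set
  Avoids321 w = ¬ (∃ λ a → ∃ λ b → ∃ λ c →
                   a < b × b < c × AffPerm.fun w a > AffPerm.fun w b × AffPerm.fun w b > AffPerm.fun w c)

  -- The root system of type Ã_{n-1}.
  -- Ambient lattice: Σ_i c_i ε_i + k δ, with ε_1..ε_n indexed by Fin n.

  Vect : Set
  Vect = (Fin n → ℤ) × ℤ

  _⊕_ : Vect → Vect → Vect
  (c , k) ⊕ (c′ , k′) = (λ m → c m + c′ m) , k + k′

  ⊖_ : Vect → Vect
  ⊖ (c , k) = (λ m → - c m) , - k

  _≈_ : Vect → Vect → Set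
  (c , k) ≈ (c′ , k′) = (∀ m → c m ≡ c′ m) × k ≡ k′

  kron : Fin n → Fin n → ℤ
  kron i j = if does (i Fin.≟ j) then 1ℤ else 0ℤ

  rootVec : Fin n → Fin n → ℤ → Vect
  rootVec i j k = (λ m → kron (m) (i) - kron (m) (j)) , k

  PositiveRoot : Vect → Set
  PositiveRoot v = ∃ λ (i : Fin n) → ∃ λ (j : Fin n) → ∃ λ (k : ℤ) →
                     i ≢ j × (k > 0ℤ ⊎ (k ≡ 0ℤ × i Fin.< j)) × v ≈ rootVec i j k

  NegativeRoot : Vect → Set
  NegativeRoot v = PositiveRoot (⊖ v)

  -- Residue of a ∈ ℤ in {1..n}, as an element of Fin n (1 ↦ 0, …, n ↦ n-1)
  residue : ℤ → Fin n
  residue a = Fin.fromℕ< (ℤ.n%ℕd<d (a - 1ℤ) n)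
    where import Data.Integer.DivMod as ℤ

  -- e(a) = ε_{ā} - ⌊(a-1)/n⌋ δ ; so e(i) = ε_i for 1 ≤ i ≤ n and e(a+n) = e(a) - δ.
  -- The linear action of w on the lattice: ε_i ↦ e(w(i)), δ ↦ δ.
  act : AffPerm → Vect → Vect
  act w (c , k) =
    (λ m → sumℤ (λ (i : Fin n) → c i * kron (m) (residue (wf i)))) ,
    (k - sumℤ (λ (i : Fin n) → c i * ((wf i - 1ℤ) /ℕ n)))
    where
      wf : Fin n → ℤ
      wf i = AffPerm.fun w (+ suc (toℕ i))

  CondIV : AffPerm → Set
  CondIV w = ¬ (∃ λ α → ∃ λ β →
                 PositiveRoot α × PositiveRoot β × PositiveRoot (α ⊕ β) ×
                 NegativeRoot (act w α) × NegativeRoot (act w β))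

-- An affine permutation is treated as a periodic bijection f of ℤ, with Shi's length
-- ℓ f = Σ_{i<j} |⌊(f j - f i)/n⌋|. Composing with the generator s_c changes ℓ by exactly one,
-- upwards iff f⁻¹ c < f⁻¹ (c + 1). Hence ℓ bounds the length of every expression, stripping
-- descents produces expressions of length ℓ f, and those are exactly the reduced ones.
--
-- (i) ⇔ (iii). In a reduced word every letter is an ascent of the word to its right, so it
-- keeps inversions; a factor s_i s_j s_i reverses three positions, giving a 321 pattern.
-- Conversely a 321 pattern can be pushed, by shrinking its value range or stripping a descent
-- that keeps it, until its values are c + 2, c + 1, c; then s_c s_{c+1} s_c starts a reduced word.
--
-- (iii) ⇔ (ii). If a < b, f b < f a and f a ≤ a, then either some a - k (0 ≤ k < n) has a larger
-- value, giving a 321 pattern, or f a is maximal on the window a - n < x ≤ a and exceeds some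
-- value there by n; summing over the window with Σ f i = Σ i then forces a < f a.
--
-- (iii) ⇔ (iv). Positive roots are e x - e y with x < y in different residue classes, w maps
-- e x to e (w x), so pairs of inverted roots with a root as sum are chained inversions.

module Submission where

open import Algebra.Bundles using (CommutativeMonoid)
import Algebra.Properties.CommutativeMonoid.Sum as MonoidSum
import Algebra.Properties.CommutativeSemigroup as CommutativeSemigroupₚ
open import Data.Empty using (⊥-elim)
open import Data.Fin as Fin using (Fin; toℕ)
import Data.Fin.Properties as Finₚ
open import Data.Fin.Permutation using (Permutation; permutation)
open import Data.Integer as ℤ using (ℤ; +_; -[1+_]; _+_; _-_; -_; _*_; _<_; _>_; _≤_; 0ℤ; 1ℤ; _%ℕ_; _/ℕ_; ∣_∣)
import Data.Integer.DivMod as ℤ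
import Data.Integer.Properties as ℤₚ
open import Data.Integer.Tactic.RingSolver using (solve-∀; solve)
open import Data.List using ([]; _∷_; _++_; length)
open import Data.Nat as ℕ using (ℕ; zero; suc; NonZero)
import Data.Nat.Properties as ℕₚ
import Data.Product
open Data.Product using (Σ; ∃; ∃-syntax; _×_; _,_; proj₁; proj₂)
open import Data.Sum using (_⊎_; inj₁; inj₂; [_,_]′)
open import Function using (_∘_; id)
open import Function.Bundles using (_⇔_; mk⇔)
open import Relation.Binary using (Tri; tri<; tri≈; tri>)
open import Relation.Binary.PropositionalEquality
  using (_≡_; _≢_; refl; sym; trans; cong; cong₂; subst; subst₂; module ≡-Reasoning)
open import Relation.Nullary using (¬_; Dec; yes; no)
open import Relation.Nullary.Decidable using (_×-dec_)

open import Defs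

private
  variable
    i j u v u₁ v₁ u₂ v₂ x y : ℤ

<⇒0<- : i < j → 0ℤ < j - i
<⇒0<- {i} {j} i<j = subst (_< j - i) (ℤₚ.+-inverseʳ i) (ℤₚ.+-monoˡ-< (- i) i<j)

0<-⇒< : 0ℤ < j - i → i < j
0<-⇒< {j} {i} 0<j-i = subst₂ _<_ (ℤₚ.+-identityʳ i) i+[j-i]≡j (ℤₚ.+-monoʳ-< i 0<j-i)
  where
  i+[j-i]≡j : i + (j - i) ≡ j
  i+[j-i]≡j = solve (i ∷ j ∷ [])

-- Linear inequalities are derived by writing the difference of the two sides as a sum of
-- differences already known to be positive; the identity itself is left to the ring solver.
<-by-diff : u₁ < v₁ → v - u ≡ v₁ - u₁ → u < v
<-by-diff u₁<v₁ eq = 0<-⇒< (subst (0ℤ <_) (sym eq) (<⇒0<- u₁<v₁))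

≤-by-diff : u₁ ≤ v₁ → v - u ≡ v₁ - u₁ → u ≤ v
≤-by-diff u₁≤v₁ eq = ℤₚ.0≤i-j⇒j≤i (subst (0ℤ ≤_) (sym eq) (ℤₚ.i≤j⇒0≤j-i u₁≤v₁))

<-by-diff₂ : u₁ < v₁ → u₂ ≤ v₂ → v - u ≡ (v₁ - u₁) + (v₂ - u₂) → u < v
<-by-diff₂ u₁<v₁ u₂≤v₂ eq =
  0<-⇒< (subst (0ℤ <_) (sym eq) (ℤₚ.+-mono-<-≤ (<⇒0<- u₁<v₁) (ℤₚ.i≤j⇒0≤j-i u₂≤v₂)))

i+1-1≡i : ∀ i → i + 1ℤ - 1ℤ ≡ i
i+1-1≡i = solve-∀

i-1+1≡i : ∀ i → i - 1ℤ + 1ℤ ≡ i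
i-1+1≡i = solve-∀

≤⇒≡+ : x ≤ y → ∃[ k ] y ≡ x + + k
≤⇒≡+ {x} {y} x≤y = ∣ y - x ∣ , (begin
  y               ≡⟨ solve (x ∷ y ∷ []) ⟩
  x + (y - x)     ≡⟨ cong (λ t → x + t) (ℤₚ.0≤i⇒+∣i∣≡i (ℤₚ.i≤j⇒0≤j-i x≤y)) ⟨
  x + + ∣ y - x ∣ ∎)
  where open ≡-Reasoning

<⇒≡+suc : x < y → ∃[ k ] y ≡ x + + suc k
<⇒≡+suc {x} x<y with ≤⇒≡+ (ℤₚ.i<j⇒suc[i]≤j x<y)
... | k , refl = k , trans (l x (+ k)) (cong (λ t → x + t) (sym (ℤₚ.pos-+ 1 k)))
  where
  l : ∀ x k → 1ℤ + x + k ≡ x + (1ℤ + k)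
  l = solve-∀

≡+suc⇒< : ∀ k → y ≡ x + + suc k → x < y
≡+suc⇒< {x = x} k refl = <-by-diff {u₁ = 0ℤ} (ℤ.+<+ (ℕ.s≤s ℕ.z≤n)) (l x (+ suc k))
  where
  l : ∀ x k → x + k - x ≡ k - 0ℤ
  l = solve-∀

i<i+1 : ∀ i → i < i + 1ℤ
i<i+1 i = ≡+suc⇒< 0 refl

i-1<i : ∀ i → i - 1ℤ < i
i-1<i i = ≡+suc⇒< 0 (sym (i-1+1≡i i))

<⇒≤-1 : x < y → x ≤ y - 1ℤ
<⇒≤-1 {x} {y} x<y = ≤-by-diff (ℤₚ.i<j⇒suc[i]≤j x<y) (l x y)
  where
  l : ∀ x y → y - 1ℤ - x ≡ y - (1ℤ + x)
  l = solve-∀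

<∧≢⇒+1< : x < y → y ≢ x + 1ℤ → x + 1ℤ < y
<∧≢⇒+1< {x} x<y y≢x+1 with <⇒≡+suc x<y
... | zero  , y≡x+1 = ⊥-elim (y≢x+1 y≡x+1)
... | suc k , refl  = ≡+suc⇒< k (l x (+ k))
  where
  l : ∀ x k → x + (1ℤ + (1ℤ + k)) ≡ x + 1ℤ + (1ℤ + k)
  l = solve-∀

<∧≢⇒<-1 : x < y → y ≢ x + 1ℤ → x < y - 1ℤ
<∧≢⇒<-1 {x} {y} x<y y≢x+1 = <-by-diff (<∧≢⇒+1< x<y y≢x+1) (l x y)
  where
  l : ∀ x y → y - 1ℤ - x ≡ y - (x + 1ℤ)
  l = solve-∀

∣i-1∣+1≡∣i∣ : 0ℤ < i → suc ∣ i - 1ℤ ∣ ≡ ∣ i ∣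
∣i-1∣+1≡∣i∣ {+ zero}  (ℤ.+<+ ())
∣i-1∣+1≡∣i∣ {+ suc k} _ = refl

∣i-1∣≡∣i∣+1 : i < 1ℤ → ∣ i - 1ℤ ∣ ≡ suc ∣ i ∣
∣i-1∣≡∣i∣+1 {+ zero}    _ = refl
∣i-1∣≡∣i∣+1 {+ suc k}   (ℤ.+<+ (ℕ.s≤s ()))
∣i-1∣≡∣i∣+1 { -[1+ k ]} _ = cong (suc ∘ suc) (ℕₚ.+-identityʳ k)

cancel-∣i∣-∣i-1∣ : ∀ {a b} → a ℕ.+ ∣ i ∣ ≡ b ℕ.+ ∣ i - 1ℤ ∣ → (0ℤ < i → suc a ≡ b) × (i < 1ℤ → a ≡ suc b)
cancel-∣i∣-∣i-1∣ {i} {a} {b} eq = positive , nonPositive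
  where
  positive : 0ℤ < i → suc a ≡ b
  positive 0<i = ℕₚ.+-cancelʳ-≡ ∣ i - 1ℤ ∣ (suc a) b (begin
    suc a ℕ.+ ∣ i - 1ℤ ∣       ≡⟨ ℕₚ.+-suc a ∣ i - 1ℤ ∣ ⟨
    a ℕ.+ suc ∣ i - 1ℤ ∣       ≡⟨ cong (a ℕ.+_) (∣i-1∣+1≡∣i∣ 0<i) ⟩
    a ℕ.+ ∣ i ∣                ≡⟨ eq ⟩
    b ℕ.+ ∣ i - 1ℤ ∣           ∎)
    where open ≡-Reasoning
  nonPositive : i < 1ℤ → a ≡ suc b
  nonPositive i<1 = ℕₚ.+-cancelʳ-≡ ∣ i ∣ a (suc b) (begin
    a ℕ.+ ∣ i ∣                ≡⟨ eq ⟩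
    b ℕ.+ ∣ i - 1ℤ ∣           ≡⟨ cong (b ℕ.+_) (∣i-1∣≡∣i∣+1 i<1) ⟩
    b ℕ.+ suc ∣ i ∣            ≡⟨ ℕₚ.+-suc b ∣ i ∣ ⟩
    suc b ℕ.+ ∣ i ∣            ∎)
    where open ≡-Reasoning

+1-equivariant⇒translation : ∀ (h : ℤ → ℤ) → (∀ y → h (y + 1ℤ) ≡ h y + 1ℤ) → ∀ y → h y ≡ y + h 0ℤ
+1-equivariant⇒translation h step y = trans (cong h (sym (ℤₚ.+-identityˡ y))) (trans (shift 0ℤ y) (ℤₚ.+-comm (h 0ℤ) y))
  where
  shift-+ : ∀ x m → h (x + + m) ≡ h x + + m
  shift-+ x zero    = trans (cong h (ℤₚ.+-identityʳ x)) (sym (ℤₚ.+-identityʳ (h x)))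
  shift-+ x (suc m) = begin
    h (x + + suc m)      ≡⟨ cong h (l x (+ m)) ⟩
    h (x + + m + 1ℤ)     ≡⟨ step (x + + m) ⟩
    h (x + + m) + 1ℤ     ≡⟨ cong (_+ 1ℤ) (shift-+ x m) ⟩
    h x + + m + 1ℤ       ≡⟨ l (h x) (+ m) ⟨
    h x + + suc m        ∎
    where
    open ≡-Reasoning
    l : ∀ x m → x + (1ℤ + m) ≡ x + m + 1ℤ
    l = solve-∀
  shift : ∀ x y → h (x + y) ≡ h x + y
  shift x (+ m)    = shift-+ x m
  shift x -[1+ m ] = begin
    h (x - M)                  ≡⟨ l₁ (h (x - M)) M ⟩
    h (x - M) + M - M          ≡⟨ cong (_- M) (shift-+ (x - M) (suc m)) ⟨
    h (x - M + M) - M          ≡⟨ cong (λ t → h t - M) (l₂ x M) ⟩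
    h x - M                    ∎
    where
    open ≡-Reasoning
    M : ℤ
    M = + suc m
    l₁ : ∀ a m → a ≡ a + m - m
    l₁ = solve-∀
    l₂ : ∀ x m → x - m + m ≡ x
    l₂ = solve-∀

module _ {c ℓ} (M : CommutativeMonoid c ℓ) where
  open CommutativeMonoid M
    renaming (_≈_ to _≈ᴹ_)
    using (Carrier; _∙_; ∙-cong; ∙-congˡ; ∙-congʳ; assoc; setoid; commutativeSemigroup)
  open MonoidSum M using (sum; sum-cong-≋)
  open CommutativeSemigroupₚ commutativeSemigroup using (xy∙z≈zy∙x)
  open import Relation.Binary.Reasoning.Setoid setoid

  sum-update : ∀ {m} (f g : Fin m → Carrier) i → (∀ j → j ≢ i → f j ≈ᴹ g j) →
               sum f ∙ g i ≈ᴹ sum g ∙ f i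
  sum-update {suc m} f g Fin.zero f≈g = begin
    f Fin.zero ∙ sum (f ∘ Fin.suc) ∙ g Fin.zero
      ≈⟨ ∙-congʳ (∙-congˡ (sum-cong-≋ (λ j → f≈g (Fin.suc j) λ ()))) ⟩
    f Fin.zero ∙ sum (g ∘ Fin.suc) ∙ g Fin.zero
      ≈⟨ xy∙z≈zy∙x _ _ _ ⟩
    g Fin.zero ∙ sum (g ∘ Fin.suc) ∙ f Fin.zero ∎
  sum-update {suc m} f g (Fin.suc i) f≈g = begin
    f Fin.zero ∙ sum (f ∘ Fin.suc) ∙ g (Fin.suc i)
      ≈⟨ assoc _ _ _ ⟩
    f Fin.zero ∙ (sum (f ∘ Fin.suc) ∙ g (Fin.suc i))
      ≈⟨ ∙-cong (f≈g Fin.zero λ ()) (sum-update (f ∘ Fin.suc) (g ∘ Fin.suc) i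
                                      (λ j j≢i → f≈g (Fin.suc j) (j≢i ∘ Finₚ.suc-injective))) ⟩
    g Fin.zero ∙ (sum (g ∘ Fin.suc) ∙ f (Fin.suc i))
      ≈⟨ assoc _ _ _ ⟨
    g Fin.zero ∙ sum (g ∘ Fin.suc) ∙ f (Fin.suc i) ∎

module ℕΣ = MonoidSum ℕₚ.+-0-commutativeMonoid
open ℕΣ using (sum-syntax)

∑∑-update : ∀ {m} (A B : Fin m → Fin m → ℕ) i₀ j₀ → (∀ i j → ¬ (i ≡ i₀ × j ≡ j₀) → A i j ≡ B i j) →
            ∑[ i < m ] ∑[ j < m ] A i j ℕ.+ B i₀ j₀ ≡ ∑[ i < m ] ∑[ j < m ] B i j ℕ.+ A i₀ j₀
∑∑-update {m} A B i₀ j₀ A≈B = ℕₚ.+-cancelʳ-≡ (ℕΣ.sum (A i₀)) _ _ (begin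
  SA ℕ.+ B i₀ j₀ ℕ.+ ℕΣ.sum (A i₀)      ≡⟨ ℕₚ.+-assoc SA (B i₀ j₀) (ℕΣ.sum (A i₀)) ⟩
  SA ℕ.+ (B i₀ j₀ ℕ.+ ℕΣ.sum (A i₀))    ≡⟨ cong (SA ℕ.+_) (trans (ℕₚ.+-comm (B i₀ j₀) (ℕΣ.sum (A i₀))) row) ⟩
  SA ℕ.+ (ℕΣ.sum (B i₀) ℕ.+ A i₀ j₀)    ≡⟨ ℕₚ.+-assoc SA (ℕΣ.sum (B i₀)) (A i₀ j₀) ⟨
  SA ℕ.+ ℕΣ.sum (B i₀) ℕ.+ A i₀ j₀      ≡⟨ cong (ℕ._+ A i₀ j₀) rows ⟩
  SB ℕ.+ ℕΣ.sum (A i₀) ℕ.+ A i₀ j₀      ≡⟨ ℕₚ.+-assoc SB (ℕΣ.sum (A i₀)) (A i₀ j₀) ⟩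
  SB ℕ.+ (ℕΣ.sum (A i₀) ℕ.+ A i₀ j₀)    ≡⟨ cong (SB ℕ.+_) (ℕₚ.+-comm (ℕΣ.sum (A i₀)) (A i₀ j₀)) ⟩
  SB ℕ.+ (A i₀ j₀ ℕ.+ ℕΣ.sum (A i₀))    ≡⟨ ℕₚ.+-assoc SB (A i₀ j₀) (ℕΣ.sum (A i₀)) ⟨
  SB ℕ.+ A i₀ j₀ ℕ.+ ℕΣ.sum (A i₀)      ∎)
  where
  open ≡-Reasoning
  SA SB : ℕ
  SA = ∑[ i < m ] ∑[ j < m ] A i j
  SB = ∑[ i < m ] ∑[ j < m ] B i j
  row : ℕΣ.sum (A i₀) ℕ.+ B i₀ j₀ ≡ ℕΣ.sum (B i₀) ℕ.+ A i₀ j₀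
  row = sum-update ℕₚ.+-0-commutativeMonoid (A i₀) (B i₀) j₀ (λ j j≢j₀ → A≈B i₀ j (j≢j₀ ∘ proj₂))
  rows : SA ℕ.+ ℕΣ.sum (B i₀) ≡ SB ℕ.+ ℕΣ.sum (A i₀)
  rows = sum-update ℕₚ.+-0-commutativeMonoid (ℕΣ.sum ∘ A) (ℕΣ.sum ∘ B) i₀
           (λ i i≢i₀ → ℕΣ.sum-cong-≗ (λ j → A≈B i j (i≢i₀ ∘ proj₁)))

module Σℤ = MonoidSum ℤₚ.+-0-commutativeMonoid

sumℤ≡sum : ∀ {m} (f : Fin m → ℤ) → sumℤ f ≡ Σℤ.sum f
sumℤ≡sum {zero}  f = refl
sumℤ≡sum {suc m} f = cong (λ t → f Fin.zero + t) (sumℤ≡sum (f ∘ Fin.suc))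

sumℤ-cong : ∀ {m} {f g : Fin m → ℤ} → (∀ i → f i ≡ g i) → sumℤ f ≡ sumℤ g
sumℤ-cong {zero}  f≗g = refl
sumℤ-cong {suc m} f≗g = cong₂ _+_ (f≗g Fin.zero) (sumℤ-cong (f≗g ∘ Fin.suc))

sumℤ-update : ∀ {m} (f g : Fin m → ℤ) i → (∀ j → j ≢ i → f j ≡ g j) → sumℤ f ≡ sumℤ g + (f i - g i)
sumℤ-update f g i f≈g = begin
  sumℤ f                       ≡⟨ l (sumℤ f) (g i) ⟩
  sumℤ f + g i - g i           ≡⟨ cong (_- g i) (trans (cong₂ _+_ (sumℤ≡sum f) refl)
                                 (trans (sum-update ℤₚ.+-0-commutativeMonoid f g i f≈g)
                                        (cong₂ _+_ (sym (sumℤ≡sum g)) refl))) ⟩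
  sumℤ g + f i - g i           ≡⟨ ℤₚ.+-assoc (sumℤ g) (f i) (- g i) ⟩
  sumℤ g + (f i - g i)         ∎
  where
  open ≡-Reasoning
  l : ∀ a b → a ≡ a + b - b
  l = solve-∀

sumℤ-+ : ∀ {m} (f g : Fin m → ℤ) → sumℤ (λ k → f k + g k) ≡ sumℤ f + sumℤ g
sumℤ-+ {zero}  f g = refl
sumℤ-+ {suc m} f g rewrite sumℤ-+ (f ∘ Fin.suc) (g ∘ Fin.suc) = l (f Fin.zero) (g Fin.zero) _ _
  where
  l : ∀ a b s t → a + b + (s + t) ≡ a + s + (b + t)
  l = solve-∀

sumℤ-neg : ∀ {m} (f : Fin m → ℤ) → sumℤ (λ k → - f k) ≡ - sumℤ f
sumℤ-neg {zero}  f = refl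
sumℤ-neg {suc m} f = trans (cong (λ t → - f Fin.zero + t) (sumℤ-neg (f ∘ Fin.suc)))
                           (sym (ℤₚ.neg-distrib-+ (f Fin.zero) _))

sumℤ-const : ∀ {m} c → sumℤ {m} (λ _ → c) ≡ + m * c
sumℤ-const {zero}  c = sym (ℤₚ.*-zeroˡ c)
sumℤ-const {suc m} c = begin
  c + sumℤ {m} (λ _ → c)  ≡⟨ cong (λ t → c + t) (sumℤ-const {m} c) ⟩
  c + + m * c             ≡⟨ cong (λ t → t + + m * c) (ℤₚ.*-identityˡ c) ⟨
  1ℤ * c + + m * c        ≡⟨ ℤₚ.*-distribʳ-+ c 1ℤ (+ m) ⟨
  (1ℤ + + m) * c          ≡⟨ cong (_* c) (ℤₚ.pos-+ 1 m) ⟨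
  + suc m * c             ∎
  where open ≡-Reasoning

sumℤ-const-minus : ∀ {m} c (f : Fin m → ℤ) → sumℤ (λ k → c - f k) ≡ + m * c - sumℤ f
sumℤ-const-minus {m} c f = begin
  sumℤ (λ k → c - f k)                 ≡⟨ sumℤ-+ (λ _ → c) (λ k → - f k) ⟩
  sumℤ {m} (λ _ → c) + sumℤ (λ k → - f k) ≡⟨ cong₂ _+_ (sumℤ-const {m} c) (sumℤ-neg f) ⟩
  + m * c - sumℤ f                     ∎
  where open ≡-Reasoning

sumℤ-*ʳ : ∀ {m} (f : Fin m → ℤ) c → sumℤ (λ k → f k * c) ≡ sumℤ f * c
sumℤ-*ʳ {zero}  f c = sym (ℤₚ.*-zeroˡ c)
sumℤ-*ʳ {suc m} f c rewrite sumℤ-*ʳ (f ∘ Fin.suc) c = sym (ℤₚ.*-distribʳ-+ c (f Fin.zero) _)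

sumℤ-nonNeg : ∀ {m} (f : Fin m → ℤ) → (∀ k → 0ℤ ≤ f k) → 0ℤ ≤ sumℤ f
sumℤ-nonNeg {zero}  f 0≤f = ℤₚ.≤-refl
sumℤ-nonNeg {suc m} f 0≤f = ℤₚ.+-mono-≤ (0≤f Fin.zero) (sumℤ-nonNeg (f ∘ Fin.suc) (0≤f ∘ Fin.suc))

term≤sumℤ : ∀ {m} (f : Fin m → ℤ) → (∀ k → 0ℤ ≤ f k) → ∀ k → f k ≤ sumℤ f
term≤sumℤ {suc m} f 0≤f Fin.zero =
  subst (_≤ sumℤ f) (ℤₚ.+-identityʳ _) (ℤₚ.+-monoʳ-≤ (f Fin.zero) (sumℤ-nonNeg (f ∘ Fin.suc) (0≤f ∘ Fin.suc)))
term≤sumℤ {suc m} f 0≤f (Fin.suc k) = subst (_≤ sumℤ f) (ℤₚ.+-identityˡ _)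
  (ℤₚ.+-mono-≤ (0≤f Fin.zero) (term≤sumℤ (f ∘ Fin.suc) (0≤f ∘ Fin.suc) k))

injective⇒surjective : ∀ {m} (φ : Fin m → Fin m) → (∀ {a b} → φ a ≡ φ b → a ≡ b) → ∀ j → ∃[ k ] φ k ≡ j
injective⇒surjective {suc m} φ φ-inj j with Finₚ.any? (λ k → φ k Finₚ.≟ j)
... | yes hit = hit
... | no miss = ⊥-elim (ℕₚ.<-irrefl refl (Finₚ.injective⇒≤ ψ-inj))
  where
  ψ : Fin (suc m) → Fin m
  ψ k = Fin.punchOut {i = j} {j = φ k} (λ eq → miss (k , sym eq))
  ψ-inj : ∀ {a b} → ψ a ≡ ψ b → a ≡ b
  ψ-inj {a} {b} eq = φ-inj (Finₚ.punchOut-injective (λ e → miss (a , sym e)) (λ e → miss (b , sym e)) eq)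

sumℤ-reindex : ∀ {m} (φ : Fin m → Fin m) → (∀ {a b} → φ a ≡ φ b → a ≡ b) →
               ∀ (f : Fin m → ℤ) → sumℤ (f ∘ φ) ≡ sumℤ f
sumℤ-reindex {m} φ φ-inj f = begin
  sumℤ (f ∘ φ)   ≡⟨ sumℤ≡sum (f ∘ φ) ⟩
  Σℤ.sum (f ∘ φ) ≡⟨ Σℤ.sum-permute f π ⟨
  Σℤ.sum f       ≡⟨ sumℤ≡sum f ⟨
  sumℤ f         ∎
  where
  open ≡-Reasoning
  φ⁻¹ : Fin m → Fin m
  φ⁻¹ j = proj₁ (injective⇒surjective φ φ-inj j)
  π : Permutation m m
  π = permutation φ φ⁻¹ (λ j → proj₂ (injective⇒surjective φ φ-inj j))
                        (λ k → φ-inj (proj₂ (injective⇒surjective φ φ-inj (φ k))))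

Has321 : (ℤ → ℤ) → Set
Has321 f = ∃[ a ] ∃[ b ] ∃[ c ] a < b × b < c × f b < f a × f c < f b

Has321-≗ : ∀ {f g} → (∀ x → f x ≡ g x) → Has321 f → Has321 g
Has321-≗ f≗g (a , b , c , a<b , b<c , fb<fa , fc<fb) =
  a , b , c , a<b , b<c , subst₂ _<_ (f≗g b) (f≗g a) fb<fa , subst₂ _<_ (f≗g c) (f≗g b) fc<fb

reflect : (ℤ → ℤ) → ℤ → ℤ
reflect f x = - f (- x)

Has321-reflect : ∀ {f} → Has321 (reflect f) → Has321 f
Has321-reflect (a , b , c , a<b , b<c , fb<fa , fc<fb) =
  - c , - b , - a , ℤₚ.neg-mono-< b<c , ℤₚ.neg-mono-< a<b , ℤₚ.neg-cancel-< fc<fb , ℤₚ.neg-cancel-< fb<fa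

module _ (n : ℕ) .{{_ : NonZero n}} where

  N : ℤ
  N = + n

  N≤*N : ∀ {k} → 0ℤ < k → N ≤ k * N
  N≤*N {k} 0<k = subst (_≤ k * N) (ℤₚ.*-identityˡ N) (ℤₚ.*-monoʳ-≤-nonNeg N (ℤₚ.i<j⇒suc[i]≤j 0<k))

  *N-pos⇒pos : ∀ {k} → 0ℤ < k * N → 0ℤ < k
  *N-pos⇒pos {k} 0<kN = ℤₚ.*-cancelʳ-<-nonNeg {0ℤ} {k} N (subst (_< k * N) (sym (ℤₚ.*-zeroˡ N)) 0<kN)

  +*N-cancel : ∀ a b q q' → a + q * N ≡ b + q' * N → a ≡ b + (q' - q) * N
  +*N-cancel a b q q' eq = begin
    a                   ≡⟨ l₁ a q N ⟩
    a + q * N - q * N   ≡⟨ cong (_- q * N) eq ⟩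
    b + q' * N - q * N  ≡⟨ l₂ b q q' N ⟩
    b + (q' - q) * N    ∎
    where
    open ≡-Reasoning
    l₁ : ∀ a q N → a ≡ a + q * N - q * N
    l₁ = solve-∀
    l₂ : ∀ b q q' N → b + q' * N - q * N ≡ b + (q' - q) * N
    l₂ = solve-∀

  private
    +r≢+r'+kN : ∀ {r r' k} → r ℕ.< n → 0ℤ < k → + r ≢ + r' + k * N
    +r≢+r'+kN {r' = r'} {k} r<n 0<k eq =
      ℤₚ.<⇒≱ (ℤ.+<+ r<n) (subst (N ≤_) (sym eq) (ℤₚ.≤-trans (N≤*N 0<k) (ℤₚ.i≤j+i (k * N) (+ r'))))

  divmod-unique : ∀ {r r' q q'} → r ℕ.< n → r' ℕ.< n → + r + q * N ≡ + r' + q' * N → r ≡ r' × q ≡ q'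
  divmod-unique {r} {r'} {q} {q'} r<n r'<n eq with ℤₚ.<-cmp q q'
  ... | tri< q<q' _ _ = ⊥-elim (+r≢+r'+kN r<n (<⇒0<- q<q') (+*N-cancel (+ r) (+ r') q q' eq))
  ... | tri> _ _ q'<q = ⊥-elim (+r≢+r'+kN r'<n (<⇒0<- q'<q) (+*N-cancel (+ r') (+ r) q' q (sym eq)))
  ... | tri≈ _ refl _ = ℤₚ.+-injective (trans (+*N-cancel (+ r) (+ r') q q eq) (l (+ r') q N)) , refl
    where
    l : ∀ r q N → r + (q - q) * N ≡ r
    l = solve-∀

  divmod : ∀ x → x ≡ + (x %ℕ n) + (x /ℕ n) * N
  divmod x = ℤ.a≡a%ℕn+[a/ℕn]*n x n

  %ℕ<n : ∀ x → x %ℕ n ℕ.< n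
  %ℕ<n x = ℤ.n%ℕd<d x n

  divmod-of : ∀ {x} r q → r ℕ.< n → x ≡ + r + q * N → x %ℕ n ≡ r × x /ℕ n ≡ q
  divmod-of {x} r q r<n x≡ = divmod-unique (%ℕ<n x) r<n (trans (sym (divmod x)) x≡)

  /ℕ-between : ∀ m d → m * N ≤ d → d < m * N + N → d /ℕ n ≡ m
  /ℕ-between m d mN≤d d<mN+N with ≤⇒≡+ mN≤d
  ... | r , refl = proj₂ (divmod-of r m r<n (ℤₚ.+-comm (m * N) (+ r)))
    where
    l : ∀ a r N → N - r ≡ a + N - (a + r)
    l = solve-∀
    r<n : r ℕ.< n
    r<n = ℤₚ.drop‿+<+ (<-by-diff d<mN+N (l (m * N) (+ r) N))

  infix 4 _≡ₙ_
  record _≡ₙ_ (x y : ℤ) : Set where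
    constructor _,_
    field
      quotient : ℤ
      proof    : x ≡ y + quotient * N

  ≡ₙ-refl : ∀ {x} → x ≡ₙ x
  ≡ₙ-refl {x} = 0ℤ , sym (ℤₚ.+-identityʳ x)

  ≡ₙ-reflexive : ∀ {x y} → x ≡ y → x ≡ₙ y
  ≡ₙ-reflexive refl = ≡ₙ-refl

  ≡ₙ-sym : ∀ {x y} → x ≡ₙ y → y ≡ₙ x
  ≡ₙ-sym {y = y} (q , refl) = - q , l y q N
    where
    l : ∀ y q N → y ≡ y + q * N + - q * N
    l = solve-∀

  ≡ₙ-trans : ∀ {x y z} → x ≡ₙ y → y ≡ₙ z → x ≡ₙ z
  ≡ₙ-trans {z = z} (q , refl) (q' , refl) = q' + q , l z q q' N
    where
    l : ∀ z q q' N → z + q' * N + q * N ≡ z + (q' + q) * N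
    l = solve-∀

  ≡ₙ-+ʳ : ∀ {x y} z → x ≡ₙ y → x + z ≡ₙ y + z
  ≡ₙ-+ʳ {y = y} z (q , refl) = q , l y q z N
    where
    l : ∀ y q z N → y + q * N + z ≡ y + z + q * N
    l = solve-∀

  ≡ₙ-+ʳ⁻¹ : ∀ {x y} z → x + z ≡ₙ y + z → x ≡ₙ y
  ≡ₙ-+ʳ⁻¹ {x} {y} z x+z≡ₙy+z = subst₂ _≡ₙ_ (l x z) (l y z) (≡ₙ-+ʳ (- z) x+z≡ₙy+z)
    where
    l : ∀ x z → x + z - z ≡ x
    l = solve-∀

  a-x≡ₙa-y⇒x≡ₙy : ∀ {a x y} → a - x ≡ₙ a - y → x ≡ₙ y
  a-x≡ₙa-y⇒x≡ₙy {a} {x} {y} (q , eq) = - q , (begin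
    x                    ≡⟨ l₁ a x ⟩
    a - (a - x)          ≡⟨ cong (λ t → a - t) eq ⟩
    a - (a - y + q * N)  ≡⟨ l₂ a y q N ⟩
    y + - q * N          ∎)
    where
    open ≡-Reasoning
    l₁ : ∀ a x → x ≡ a - (a - x)
    l₁ = solve-∀
    l₂ : ∀ a y q N → a - (a - y + q * N) ≡ y + - q * N
    l₂ = solve-∀

  +*N-≡ₙ : ∀ x q → x + q * N ≡ₙ x
  +*N-≡ₙ x q = q , refl

  +*N-divmod : ∀ x q → (x + q * N) %ℕ n ≡ x %ℕ n × (x + q * N) /ℕ n ≡ x /ℕ n + q
  +*N-divmod x q = divmod-of (x %ℕ n) (x /ℕ n + q) (%ℕ<n x) (begin
    x + q * N                              ≡⟨ cong (_+ q * N) (divmod x) ⟩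
    + (x %ℕ n) + x /ℕ n * N + q * N        ≡⟨ l (+ (x %ℕ n)) (x /ℕ n) q N ⟩
    + (x %ℕ n) + (x /ℕ n + q) * N          ∎)
    where
    open ≡-Reasoning
    l : ∀ r Q q N → r + Q * N + q * N ≡ r + (Q + q) * N
    l = solve-∀

  ≡ₙ⇒%ℕ≡ : ∀ {x y} → x ≡ₙ y → x %ℕ n ≡ y %ℕ n
  ≡ₙ⇒%ℕ≡ {y = y} (q , refl) = proj₁ (+*N-divmod y q)

  %ℕ≡⇒≡ₙ : ∀ {x y} → x %ℕ n ≡ y %ℕ n → x ≡ₙ y
  %ℕ≡⇒≡ₙ {x} {y} eq = x /ℕ n - y /ℕ n , (begin
    x                                  ≡⟨ divmod x ⟩
    + (x %ℕ n) + x /ℕ n * N            ≡⟨ cong (λ r → + r + x /ℕ n * N) eq ⟩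
    + (y %ℕ n) + x /ℕ n * N            ≡⟨ l (+ (y %ℕ n)) (x /ℕ n) (y /ℕ n) N ⟩
    + (y %ℕ n) + y /ℕ n * N + (x /ℕ n - y /ℕ n) * N  ≡⟨ cong (_+ (x /ℕ n - y /ℕ n) * N) (divmod y) ⟨
    y + (x /ℕ n - y /ℕ n) * N          ∎)
    where
    open ≡-Reasoning
    l : ∀ r Q Q' N → r + Q * N ≡ r + Q' * N + (Q - Q') * N
    l = solve-∀

  _≡ₙ?_ : ∀ x y → Dec (x ≡ₙ y)
  x ≡ₙ? y with x %ℕ n ℕ.≟ y %ℕ n
  ... | yes eq = yes (%ℕ≡⇒≡ₙ eq)
  ... | no neq = no (neq ∘ ≡ₙ⇒%ℕ≡)

  -%ℕ≡0⇒≡ₙ : ∀ x y → (x - y) %ℕ n ≡ 0 → x ≡ₙ y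
  -%ℕ≡0⇒≡ₙ x y eq = (x - y) /ℕ n , (begin
    x                          ≡⟨ l x y ⟩
    y + (x - y)                ≡⟨ cong (λ t → y + t) (divmod (x - y)) ⟩
    y + (+ ((x - y) %ℕ n) + (x - y) /ℕ n * N)  ≡⟨ cong (λ r → y + (+ r + (x - y) /ℕ n * N)) eq ⟩
    y + (0ℤ + (x - y) /ℕ n * N)  ≡⟨ cong (λ t → y + t) (ℤₚ.+-identityˡ _) ⟩
    y + (x - y) /ℕ n * N       ∎)
    where
    open ≡-Reasoning
    l : ∀ x y → x ≡ y + (x - y)
    l = solve-∀

  ≡ₙ⇒-%ℕ≡0 : ∀ x y → x ≡ₙ y → (x - y) %ℕ n ≡ 0
  ≡ₙ⇒-%ℕ≡0 x y (q , refl) = proj₁ (divmod-of 0 q (ℕ.>-nonZero⁻¹ n) (l y q N))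
    where
    l : ∀ y q N → y + q * N - y ≡ 0ℤ + q * N
    l = solve-∀

  x+k≢ₙx : ∀ x k → 0 ℕ.< k → k ℕ.< n → ¬ (x + + k ≡ₙ x)
  x+k≢ₙx x k 0<k k<n x+k≡ₙx = ℕₚ.<⇒≢ 0<k (sym (trans (sym k%n≡k) k%n≡0))
    where
    k%n≡k : + k %ℕ n ≡ k
    k%n≡k = proj₁ (divmod-of k 0ℤ k<n (sym (ℤₚ.+-identityʳ (+ k))))
    k%n≡0 : + k %ℕ n ≡ 0
    k%n≡0 = trans (cong (_%ℕ n) (l x (+ k))) (≡ₙ⇒-%ℕ≡0 (x + + k) x x+k≡ₙx)
      where
      l : ∀ x k → k ≡ x + k - x
      l = solve-∀

  ≡ₙ-gap : ∀ {y z} → y ≡ₙ z → z < y → z + N ≤ y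
  ≡ₙ-gap {z = z} (q , refl) z<z+qN = ℤₚ.+-monoʳ-≤ z (N≤*N (*N-pos⇒pos {q} (<-by-diff z<z+qN (l z q N))))
    where
    l : ∀ z q N → q * N - 0ℤ ≡ z + q * N - z
    l = solve-∀

  rep : Fin n → ℤ
  rep k = + suc (toℕ k)

  block : ℤ → ℤ
  block x = (x - 1ℤ) /ℕ n

  rep≡1+ : ∀ k → rep k ≡ 1ℤ + + toℕ k
  rep≡1+ k = ℤₚ.pos-+ 1 (toℕ k)

  rep<rep : ∀ {k k'} → k Fin.< k' → rep k < rep k'
  rep<rep k<k' = ℤ.+<+ (ℕ.s≤s k<k')

  rep<rep+N : ∀ k k' → rep k' < rep k + N
  rep<rep+N k k' = ℤ.+<+ (ℕ.s≤s (ℕₚ.<-≤-trans (Finₚ.toℕ<n k') (ℕₚ.m≤n+m n (toℕ k))))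

  rep-residue-block : ∀ x → x ≡ rep (residue n x) + block x * N
  rep-residue-block x = begin
    x                                                ≡⟨ l₁ x ⟩
    1ℤ + (x - 1ℤ)                                    ≡⟨ cong (λ t → 1ℤ + t) (divmod (x - 1ℤ)) ⟩
    1ℤ + (+ ((x - 1ℤ) %ℕ n) + block x * N)            ≡⟨ l₂ (+ ((x - 1ℤ) %ℕ n)) (block x) N ⟩
    1ℤ + + ((x - 1ℤ) %ℕ n) + block x * N              ≡⟨ cong (λ r → 1ℤ + + r + block x * N) (Finₚ.toℕ-fromℕ< (%ℕ<n (x - 1ℤ))) ⟨
    1ℤ + + toℕ (residue n x) + block x * N            ≡⟨ cong (_+ block x * N) (rep≡1+ (residue n x)) ⟨
    rep (residue n x) + block x * N                  ∎
    where
    open ≡-Reasoning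
    l₁ : ∀ x → x ≡ 1ℤ + (x - 1ℤ)
    l₁ = solve-∀
    l₂ : ∀ r Q N → 1ℤ + (r + Q * N) ≡ 1ℤ + r + Q * N
    l₂ = solve-∀

  ≡ₙ-rep-residue : ∀ x → x ≡ₙ rep (residue n x)
  ≡ₙ-rep-residue x = block x , rep-residue-block x

  divmod-rep : ∀ k q → (rep k + q * N - 1ℤ) %ℕ n ≡ toℕ k × block (rep k + q * N) ≡ q
  divmod-rep k q = divmod-of (toℕ k) q (Finₚ.toℕ<n k) (begin
    rep k + q * N - 1ℤ              ≡⟨ cong (λ t → t + q * N - 1ℤ) (rep≡1+ k) ⟩
    1ℤ + + toℕ k + q * N - 1ℤ       ≡⟨ l (+ toℕ k) q N ⟩
    + toℕ k + q * N                 ∎)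
    where
    open ≡-Reasoning
    l : ∀ r q N → 1ℤ + r + q * N - 1ℤ ≡ r + q * N
    l = solve-∀

  residue-rep+*N : ∀ k q → residue n (rep k + q * N) ≡ k
  residue-rep+*N k q = Finₚ.toℕ-injective
    (trans (Finₚ.toℕ-fromℕ< (%ℕ<n (rep k + q * N - 1ℤ))) (proj₁ (divmod-rep k q)))

  block-rep+*N : ∀ k q → block (rep k + q * N) ≡ q
  block-rep+*N k q = proj₂ (divmod-rep k q)

  residue-rep : ∀ k → residue n (rep k) ≡ k
  residue-rep k = subst (λ x → residue n x ≡ k) (ℤₚ.+-identityʳ (rep k)) (residue-rep+*N k 0ℤ)

  block-rep : ∀ k → block (rep k) ≡ 0ℤ
  block-rep k = subst (λ x → block x ≡ 0ℤ) (ℤₚ.+-identityʳ (rep k)) (block-rep+*N k 0ℤ)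

  ≡ₙ⇒residue≡ : ∀ {x y} → x ≡ₙ y → residue n x ≡ residue n y
  ≡ₙ⇒residue≡ {x} {y} x≡ₙy = Finₚ.toℕ-injective (begin
    toℕ (residue n x)   ≡⟨ Finₚ.toℕ-fromℕ< (%ℕ<n (x - 1ℤ)) ⟩
    (x - 1ℤ) %ℕ n       ≡⟨ ≡ₙ⇒%ℕ≡ (≡ₙ-+ʳ (- 1ℤ) x≡ₙy) ⟩
    (y - 1ℤ) %ℕ n       ≡⟨ Finₚ.toℕ-fromℕ< (%ℕ<n (y - 1ℤ)) ⟨
    toℕ (residue n y)   ∎)
    where open ≡-Reasoning

  residue≡⇒≡ₙ : ∀ {x y} → residue n x ≡ residue n y → x ≡ₙ y
  residue≡⇒≡ₙ {x} {y} eq =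
    ≡ₙ-trans (≡ₙ-rep-residue x) (subst (λ k → rep k ≡ₙ y) (sym eq) (≡ₙ-sym (≡ₙ-rep-residue y)))

  rep-injectiveₙ : ∀ {k k'} → rep k ≡ₙ rep k' → k ≡ k'
  rep-injectiveₙ {k} {k'} rep-k≡ₙrep-k' =
    trans (sym (residue-rep k)) (trans (≡ₙ⇒residue≡ rep-k≡ₙrep-k') (residue-rep k'))

  toℕ-injectiveₙ : ∀ {k k' : Fin n} → + toℕ k ≡ₙ + toℕ k' → k ≡ k'
  toℕ-injectiveₙ {k} {k'} k≡ₙk' = rep-injectiveₙ (subst₂ _≡ₙ_ (1+≡rep k) (1+≡rep k') (≡ₙ-+ʳ 1ℤ k≡ₙk'))
    where
    1+≡rep : ∀ k → + toℕ k + 1ℤ ≡ rep k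
    1+≡rep k = trans (ℤₚ.+-comm (+ toℕ k) 1ℤ) (sym (rep≡1+ k))

  -- AffPerm without its sum condition (see Balanced), which only some of the arguments need.
  record IsPeriodicBijection (f : ℤ → ℤ) : Set where
    field
      inv      : ℤ → ℤ
      inv-f    : ∀ x → inv (f x) ≡ x
      f-inv    : ∀ y → f (inv y) ≡ y
      periodic : ∀ x → f (x + N) ≡ f x + N

    injective : ∀ {x y} → f x ≡ f y → x ≡ y
    injective {x} {y} fx≡fy = trans (sym (inv-f x)) (trans (cong inv fx≡fy) (inv-f y))

    periodic-+ : ∀ x k → f (x + + k * N) ≡ f x + + k * N
    periodic-+ x zero    = trans (cong f (ℤₚ.+-identityʳ x)) (sym (ℤₚ.+-identityʳ (f x)))
    periodic-+ x (suc k) = begin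
      f (x + + suc k * N)      ≡⟨ cong f (l x (+ k) N) ⟩
      f (x + + k * N + N)      ≡⟨ periodic (x + + k * N) ⟩
      f (x + + k * N) + N      ≡⟨ cong (_+ N) (periodic-+ x k) ⟩
      f x + + k * N + N        ≡⟨ l (f x) (+ k) N ⟨
      f x + + suc k * N        ∎
      where
      open ≡-Reasoning
      l : ∀ x k N → x + (1ℤ + k) * N ≡ x + k * N + N
      l = solve-∀

    periodic-* : ∀ x q → f (x + q * N) ≡ f x + q * N
    periodic-* x (+ k)    = periodic-+ x k
    periodic-* x -[1+ k ] = begin
      f (x + - K * N)                    ≡⟨ l₁ (f (x + - K * N)) K N ⟩
      f (x + - K * N) + K * N - K * N    ≡⟨ cong (_- K * N) (periodic-+ (x + - K * N) (suc k)) ⟨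
      f (x + - K * N + K * N) - K * N    ≡⟨ cong (λ t → f t - K * N) (l₂ x K N) ⟩
      f x - K * N                        ≡⟨ l₃ (f x) K N ⟩
      f x + - K * N                      ∎
      where
      open ≡-Reasoning
      K : ℤ
      K = + suc k
      l₁ : ∀ a k N → a ≡ a + k * N - k * N
      l₁ = solve-∀
      l₂ : ∀ x k N → x + - k * N + k * N ≡ x
      l₂ = solve-∀
      l₃ : ∀ a k N → a - k * N ≡ a + - k * N
      l₃ = solve-∀

    inv-periodic-* : ∀ y q → inv (y + q * N) ≡ inv y + q * N
    inv-periodic-* y q = injective (begin
      f (inv (y + q * N))   ≡⟨ f-inv (y + q * N) ⟩
      y + q * N             ≡⟨ cong (_+ q * N) (f-inv y) ⟨
      f (inv y) + q * N     ≡⟨ periodic-* (inv y) q ⟨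
      f (inv y + q * N)     ∎)
      where open ≡-Reasoning

    ≡ₙ-map : ∀ {x y} → x ≡ₙ y → f x ≡ₙ f y
    ≡ₙ-map {y = y} (q , refl) = q , periodic-* y q

    ≡ₙ-inv : ∀ {x y} → x ≡ₙ y → inv x ≡ₙ inv y
    ≡ₙ-inv {y = y} (q , refl) = q , inv-periodic-* y q

    ≡ₙ-unmap : ∀ {x y} → f x ≡ₙ f y → x ≡ₙ y
    ≡ₙ-unmap {x} {y} fx≡ₙfy = subst₂ _≡ₙ_ (inv-f x) (inv-f y) (≡ₙ-inv fx≡ₙfy)

    f-rep-residue : ∀ y → f (rep (residue n (inv y))) ≡ y + - block (inv y) * N
    f-rep-residue y = begin
      f r                        ≡⟨ cong f (+*N-cancel r (inv y) q 0ℤ (trans (sym (rep-residue-block (inv y)))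
                                                                        (sym (ℤₚ.+-identityʳ (inv y))))) ⟩
      f (inv y + (0ℤ - q) * N)   ≡⟨ periodic-* (inv y) (0ℤ - q) ⟩
      f (inv y) + (0ℤ - q) * N   ≡⟨ cong₂ (λ a b → a + b * N) (f-inv y) (ℤₚ.+-identityˡ (- q)) ⟩
      y + - q * N                ∎
      where
      open ≡-Reasoning
      r q : ℤ
      r = rep (residue n (inv y))
      q = block (inv y)

  module PB = IsPeriodicBijection

  id-isPB : IsPeriodicBijection id
  id-isPB = record { inv = id ; inv-f = λ _ → refl ; f-inv = λ _ → refl ; periodic = λ _ → refl }

  ∘-isPB : ∀ {f g} → IsPeriodicBijection f → IsPeriodicBijection g → IsPeriodicBijection (f ∘ g)
  ∘-isPB {f} {g} F G = record
    { inv      = PB.inv G ∘ PB.inv F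
    ; inv-f    = λ x → trans (cong (PB.inv G) (PB.inv-f F (g x))) (PB.inv-f G x)
    ; f-inv    = λ y → trans (cong f (PB.f-inv G (PB.inv F y))) (PB.f-inv F y)
    ; periodic = λ x → trans (cong f (PB.periodic G x)) (PB.periodic F (g x))
    }

  ≗-isPB : ∀ {f g} → (∀ x → f x ≡ g x) → IsPeriodicBijection f → IsPeriodicBijection g
  ≗-isPB {f} {g} f≗g F = record
    { inv      = PB.inv F
    ; inv-f    = λ x → trans (cong (PB.inv F) (sym (f≗g x))) (PB.inv-f F x)
    ; f-inv    = λ y → trans (sym (f≗g (PB.inv F y))) (PB.f-inv F y)
    ; periodic = λ x → trans (sym (f≗g (x + N))) (trans (PB.periodic F x) (cong (_+ N) (f≗g x)))
    }

  rep-order : ∀ {a b} → a Fin.< b → ∀ x y →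
              (rep b + y * N < rep a + x * N → 0ℤ < x - y) × (rep a + x * N < rep b + y * N → x - y < 1ℤ)
  rep-order {a} {b} a<b x y = below , above
    where
    below : rep b + y * N < rep a + x * N → 0ℤ < x - y
    below b+yN<a+xN = *N-pos⇒pos {x - y}
      (<-by-diff₂ (rep<rep a<b) (ℤₚ.<⇒≤ b+yN<a+xN) (l (rep a) (rep b) x y N))
      where
      l : ∀ a b x y N → (x - y) * N - 0ℤ ≡ (b - a) + (a + x * N - (b + y * N))
      l = solve-∀
    above : rep a + x * N < rep b + y * N → x - y < 1ℤ
    above a+xN<b+yN = ℤₚ.*-cancelʳ-<-nonNeg {x - y} {1ℤ} N (subst ((x - y) * N <_) (sym (ℤₚ.*-identityˡ N))
      (<-by-diff₂ (rep<rep+N a b) (ℤₚ.<⇒≤ a+xN<b+yN) (l (rep a) (rep b) x y N)))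
      where
      l : ∀ a b x y N → N - (x - y) * N ≡ (a + N - b) + (b + y * N - (a + x * N))
      l = solve-∀

  inversions : (ℤ → ℤ) → Fin n → Fin n → ℕ
  inversions f i j with i Fin.<? j
  ... | yes _ = ∣ (f (rep j) - f (rep i)) /ℕ n ∣
  ... | no  _ = 0

  ℓ : (ℤ → ℤ) → ℕ
  ℓ f = ∑[ i < n ] ∑[ j < n ] inversions f i j

  inversions-< : ∀ f {i j} → i Fin.< j → inversions f i j ≡ ∣ (f (rep j) - f (rep i)) /ℕ n ∣
  inversions-< f {i} {j} i<j with i Fin.<? j
  ... | yes _   = refl
  ... | no  i≮j = ⊥-elim (i≮j i<j)

  inversions-≮ : ∀ f {i j} → ¬ i Fin.< j → inversions f i j ≡ 0
  inversions-≮ f {i} {j} i≮j with i Fin.<? j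
  ... | yes i<j = ⊥-elim (i≮j i<j)
  ... | no  _   = refl

  inversions-cong : ∀ f g i j → (i Fin.< j → (f (rep j) - f (rep i)) /ℕ n ≡ (g (rep j) - g (rep i)) /ℕ n) →
                    inversions f i j ≡ inversions g i j
  inversions-cong f g i j same with i Fin.<? j
  ... | yes i<j = cong ∣_∣ (same i<j)
  ... | no  _   = refl

  ℓ-cong : ∀ {f g} → (∀ x → f x ≡ g x) → ℓ f ≡ ℓ g
  ℓ-cong {f} {g} f≗g = ℕΣ.sum-cong-≗ λ i → ℕΣ.sum-cong-≗ λ j →
    inversions-cong f g i j (λ _ → cong₂ (λ a b → (a - b) /ℕ n) (f≗g (rep j)) (f≗g (rep i)))

  ℓ-id : ℓ id ≡ 0
  ℓ-id = trans (ℕΣ.sum-cong-≗ (λ i → trans (ℕΣ.sum-cong-≗ (no-inversions i)) (ℕΣ.sum-replicate-zero n)))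
               (ℕΣ.sum-replicate-zero n)
    where
    no-inversions : ∀ i j → inversions id i j ≡ 0
    no-inversions i j with i Fin.<? j
    ... | no  _   = refl
    ... | yes i<j = cong ∣_∣ (/ℕ-between 0ℤ (rep j - rep i)
                      (ℤₚ.i≤j⇒0≤j-i (ℤₚ.<⇒≤ (rep<rep i<j)))
                      (<-by-diff (rep<rep+N i j) (l (rep i) (rep j) N)))
      where
      l : ∀ a b N → 0ℤ * N + N - (b - a) ≡ a + N - b
      l = solve-∀

  ℓ-update : ∀ f g i₀ j₀ → (∀ i j → ¬ (i ≡ i₀ × j ≡ j₀) → inversions f i j ≡ inversions g i j) →
             ℓ f ℕ.+ inversions g i₀ j₀ ≡ ℓ g ℕ.+ inversions f i₀ j₀
  ℓ-update f g = ∑∑-update (inversions f) (inversions g)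

  Balanced : (ℤ → ℤ) → Set
  Balanced f = sumℤ (f ∘ rep) ≡ sumℤ rep

  window : ℤ → Fin n → ℤ
  window a k = a - + toℕ k

  window-injectiveₙ : ∀ a {k k'} → window a k ≡ₙ window a k' → k ≡ k'
  window-injectiveₙ a = toℕ-injectiveₙ ∘ a-x≡ₙa-y⇒x≡ₙy {a}

  Σtoℕ : ℤ
  Σtoℕ = sumℤ (λ (k : Fin n) → + toℕ k)

  sum-window : ∀ a → sumℤ (window a) ≡ N * a - Σtoℕ
  sum-window a = sumℤ-const-minus {n} a (λ k → + toℕ k)

  module _ {f} (F : IsPeriodicBijection f) (balanced : Balanced f) where
    open IsPeriodicBijection F

    -- f x - x is n-periodic and a window of n consecutive integers meets each residue class once.
    balanced-window : ∀ a → sumℤ (f ∘ window a) ≡ sumℤ (window a)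
    balanced-window a = begin
      sumℤ (f ∘ window a)                          ≡⟨ sumℤ-cong (λ k → l (f (window a k)) (window a k)) ⟩
      sumℤ (λ k → D (window a k) + window a k)     ≡⟨ sumℤ-+ (D ∘ window a) (window a) ⟩
      sumℤ (D ∘ window a) + sumℤ (window a)        ≡⟨ cong (_+ sumℤ (window a)) ΣD≡0 ⟩
      0ℤ + sumℤ (window a)                         ≡⟨ ℤₚ.+-identityˡ _ ⟩
      sumℤ (window a)                              ∎
      where
      open ≡-Reasoning
      D : ℤ → ℤ
      D x = f x - x
      l : ∀ y x → y ≡ y - x + x
      l = solve-∀
      D-residue : ∀ x → D x ≡ D (rep (residue n x))
      D-residue x = begin
        D x                                              ≡⟨ cong D (rep-residue-block x) ⟩
        f (r + block x * N) - (r + block x * N)          ≡⟨ cong (_- (r + block x * N)) (periodic-* r (block x)) ⟩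
        f r + block x * N - (r + block x * N)            ≡⟨ l′ (f r) r (block x * N) ⟩
        D r                                              ∎
        where
        r : ℤ
        r = rep (residue n x)
        l′ : ∀ y r m → y + m - (r + m) ≡ y - r
        l′ = solve-∀
      ΣD≡0 : sumℤ (D ∘ window a) ≡ 0ℤ
      ΣD≡0 = begin
        sumℤ (D ∘ window a)                            ≡⟨ sumℤ-cong (D-residue ∘ window a) ⟩
        sumℤ (D ∘ rep ∘ residue n ∘ window a)          ≡⟨ sumℤ-reindex (residue n ∘ window a)
                                                            (window-injectiveₙ a ∘ residue≡⇒≡ₙ) (D ∘ rep) ⟩
        sumℤ (D ∘ rep)                                 ≡⟨ sumℤ-+ (f ∘ rep) (λ k → - rep k) ⟩
        sumℤ (f ∘ rep) + sumℤ (λ k → - rep k)          ≡⟨ cong₂ _+_ balanced (sumℤ-neg rep) ⟩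
        sumℤ rep - sumℤ rep                            ≡⟨ ℤₚ.+-inverseʳ (sumℤ rep) ⟩
        0ℤ                                             ∎

    window-gap : ℤ → Fin n → ℤ
    window-gap a k = f a - f (window a k)

    sum-window-gap : ∀ a → sumℤ (window-gap a) ≡ N * f a - (N * a - Σtoℕ)
    sum-window-gap a = trans (sumℤ-const-minus (f a) (f ∘ window a))
                             (cong (λ t → N * f a - t) (trans (balanced-window a) (sum-window a)))

    -- The gaps have pairwise distinct residues, so their remainders add up to 0 + 1 + ⋯ + (n - 1).
    sum-window-gap-divmod : ∀ a → sumℤ (window-gap a) ≡ Σtoℕ + sumℤ (λ k → window-gap a k /ℕ n) * N
    sum-window-gap-divmod a = begin
      sumℤ d                                             ≡⟨ sumℤ-cong (divmod ∘ d) ⟩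
      sumℤ (λ k → + (d k %ℕ n) + d k /ℕ n * N)           ≡⟨ sumℤ-+ (λ k → + (d k %ℕ n)) (λ k → d k /ℕ n * N) ⟩
      sumℤ (λ k → + (d k %ℕ n)) + sumℤ (λ k → d k /ℕ n * N) ≡⟨ cong₂ _+_ ΣR≡ΣT (sumℤ-*ʳ (λ k → d k /ℕ n) N) ⟩
      Σtoℕ + sumℤ (λ k → d k /ℕ n) * N                   ∎
      where
      open ≡-Reasoning
      d : Fin n → ℤ
      d = window-gap a
      φ : Fin n → Fin n
      φ k = Fin.fromℕ< (%ℕ<n (d k))
      φ-injective : ∀ {k k'} → φ k ≡ φ k' → k ≡ k'
      φ-injective {k} {k'} φk≡φk' = window-injectiveₙ a (≡ₙ-unmap (a-x≡ₙa-y⇒x≡ₙy {f a} (%ℕ≡⇒≡ₙ (begin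
        d k %ℕ n     ≡⟨ Finₚ.toℕ-fromℕ< (%ℕ<n (d k)) ⟨
        toℕ (φ k)    ≡⟨ cong toℕ φk≡φk' ⟩
        toℕ (φ k')   ≡⟨ Finₚ.toℕ-fromℕ< (%ℕ<n (d k')) ⟩
        d k' %ℕ n    ∎))))
      ΣR≡ΣT : sumℤ (λ k → + (d k %ℕ n)) ≡ Σtoℕ
      ΣR≡ΣT = trans (sumℤ-cong (λ k → cong +_ (sym (Finₚ.toℕ-fromℕ< (%ℕ<n (d k))))))
                    (sumℤ-reindex φ φ-injective (λ k → + toℕ k))

    f≡+sum-window-gap/ℕ : ∀ a → f a ≡ a + sumℤ (λ k → window-gap a k /ℕ n)
    f≡+sum-window-gap/ℕ a = l (f a) a ΣQ (ℤₚ.*-cancelˡ-≡ N (f a - a - ΣQ) 0ℤ (begin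
      N * (f a - a - ΣQ)                      ≡⟨ l′ N (f a) a ΣQ ΣT ⟩
      N * f a - (N * a - ΣT) - (ΣT + ΣQ * N)  ≡⟨ cong₂ _-_ (sum-window-gap a) (sum-window-gap-divmod a) ⟨
      sumℤ (window-gap a) - sumℤ (window-gap a) ≡⟨ ℤₚ.+-inverseʳ (sumℤ (window-gap a)) ⟩
      0ℤ                                      ≡⟨ ℤₚ.*-zeroʳ N ⟨
      N * 0ℤ                                  ∎))
      where
      open ≡-Reasoning
      ΣT ΣQ : ℤ
      ΣT = Σtoℕ
      ΣQ = sumℤ (λ k → window-gap a k /ℕ n)
      l′ : ∀ N M a q t → N * (M - a - q) ≡ N * M - (N * a - t) - (t + q * N)
      l′ = solve-∀
      l : ∀ M a q → M - a - q ≡ 0ℤ → M ≡ a + q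
      l M a q eq = trans (l₁ M a q) (trans (cong (_+ (a + q)) eq) (ℤₚ.+-identityˡ (a + q)))
        where
        l₁ : ∀ M a q → M ≡ M - a - q + (a + q)
        l₁ = solve-∀

    window-maximum⇒< : ∀ a → (∀ k → f (window a k) ≤ f a) → ∀ k₁ → f (window a k₁) + N ≤ f a → a < f a
    window-maximum⇒< a maximum k₁ far = subst (a <_) (sym (f≡+sum-window-gap/ℕ a))
      (<-by-diff (ℤₚ.<-≤-trans 0<Qk₁ (term≤sumℤ Q 0≤Q k₁)) (l a (sumℤ Q)))
      where
      l : ∀ a q → a + q - a ≡ q - 0ℤ
      l = solve-∀
      Q : Fin n → ℤ
      Q k = window-gap a k /ℕ n
      0≤Q : ∀ k → 0ℤ ≤ Q k
      0≤Q k = ℤ.0≤n⇒0≤n/ℕd (window-gap a k) n (ℤₚ.i≤j⇒0≤j-i (maximum k))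
      0<Qk₁ : 0ℤ < Q k₁
      0<Qk₁ = *N-pos⇒pos (<-by-diff₂ (ℤ.+<+ (%ℕ<n d)) N≤d eq)
        where
        d : ℤ
        d = window-gap a k₁
        N≤d : N ≤ d
        N≤d = ≤-by-diff far (l′ (f a) (f (window a k₁)) N)
          where
          l′ : ∀ M y N → M - y - N ≡ M - (y + N)
          l′ = solve-∀
        eq : Q k₁ * N - 0ℤ ≡ (N - + (d %ℕ n)) + (d - N)
        eq = trans (l′ (+ (d %ℕ n)) (Q k₁) N) (cong (λ t → N - + (d %ℕ n) + (t - N)) (sym (divmod d)))
          where
          l′ : ∀ r q N → q * N - 0ℤ ≡ N - r + (r + q * N - N)
          l′ = solve-∀

    inversion⇒far-in-window : ∀ {a b} → a < b → f b < f a → ∃[ k₁ ] f (window a k₁) + N ≤ f a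
    inversion⇒far-in-window {a} {b} a<b fb<fa = k₁ , ℤₚ.<⇒≤ (ℤₚ.≤-<-trans (begin
        f (window a k₁) + N              ≤⟨ ℤₚ.+-monoʳ-≤ (f (window a k₁)) (N≤*N 0<-q) ⟩
        f (window a k₁) + - q * N        ≡⟨ periodic-* (window a k₁) (- q) ⟨
        f (window a k₁ + - q * N)        ≡⟨ cong f b≡w+qN ⟨
        f b                              ∎) fb<fa)
      where
      open ℤₚ.≤-Reasoning
      k₁ : Fin n
      k₁ = Fin.fromℕ< (%ℕ<n (a - b))
      q : ℤ
      q = (a - b) /ℕ n
      b≡w+qN : b ≡ window a k₁ + - q * N
      b≡w+qN = trans (l₁ a b) (trans (cong (λ t → a - t) (divmod (a - b))) (trans (l₂ a (+ ((a - b) %ℕ n)) q N)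
                 (cong (λ r → a - + r + - q * N) (sym (Finₚ.toℕ-fromℕ< (%ℕ<n (a - b)))))))
        where
        l₁ : ∀ a b → b ≡ a - (a - b)
        l₁ = solve-∀
        l₂ : ∀ a r q N → a - (r + q * N) ≡ a - r + - q * N
        l₂ = solve-∀
      w≤a : window a k₁ ≤ a
      w≤a = ≤-by-diff {u₁ = 0ℤ} (ℤ.+≤+ ℕ.z≤n) (l a (+ toℕ k₁))
        where
        l : ∀ a k → a - (a - k) ≡ k - 0ℤ
        l = solve-∀
      0<-q : 0ℤ < - q
      0<-q = *N-pos⇒pos (<-by-diff (ℤₚ.≤-<-trans w≤a a<b)
                                   (trans (l (window a k₁) (- q * N)) (cong (_- window a k₁) (sym b≡w+qN))))
        where
        l : ∀ w x → x - 0ℤ ≡ w + x - w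
        l = solve-∀

    inversion∧fa≤a⇒321 : ∀ a b → a < b → f b < f a → f a ≤ a → Has321 f
    inversion∧fa≤a⇒321 a b a<b fb<fa fa≤a with Finₚ.any? (λ k → f a ℤₚ.<? f (window a k))
    ... | yes (k , fa<fw) = window a k , a , b , w<a (toℕ k) fa<fw , a<b , fa<fw , fb<fa
      where
      w<a : ∀ m → f a < f (a - + m) → a - + m < a
      w<a zero    fa<fa = ⊥-elim (ℤₚ.<-irrefl (cong f (sym (ℤₚ.+-identityʳ a))) fa<fa)
      w<a (suc m) _     = ≡+suc⇒< m (l a (+ suc m))
        where
        l : ∀ a m → a ≡ a - m + m
        l = solve-∀
    ... | no ¬above = ⊥-elim (ℤₚ.<⇒≱ (window-maximum⇒< a maximum k₁ far) fa≤a)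
      where
      maximum : ∀ k → f (window a k) ≤ f a
      maximum k = ℤₚ.≮⇒≥ (λ fa<fw → ¬above (k , fa<fw))
      k₁ : Fin n
      k₁ = proj₁ (inversion⇒far-in-window a<b fb<fa)
      far : f (window a k₁) + N ≤ f a
      far = proj₂ (inversion⇒far-in-window a<b fb<fa)

  reflect-isPB : ∀ {f} → IsPeriodicBijection f → IsPeriodicBijection (reflect f)
  reflect-isPB {f} F = record
    { inv      = reflect (PB.inv F)
    ; inv-f    = λ x → trans (cong (λ t → - PB.inv F t) (ℤₚ.neg-involutive (f (- x))))
                             (trans (cong -_ (PB.inv-f F (- x))) (ℤₚ.neg-involutive x))
    ; f-inv    = λ y → trans (cong (λ t → - f t) (ℤₚ.neg-involutive (PB.inv F (- y))))
                             (trans (cong -_ (PB.f-inv F (- y))) (ℤₚ.neg-involutive y))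
    ; periodic = λ x → trans (cong (λ t → - f t) (l₁ x N)) (trans (cong -_ (PB.periodic-* F (- x) (- 1ℤ))) (l₂ (f (- x)) N))
    }
    where
    l₁ : ∀ x N → - (x + N) ≡ - x + - 1ℤ * N
    l₁ = solve-∀
    l₂ : ∀ y N → - (y + - 1ℤ * N) ≡ - y + N
    l₂ = solve-∀

  reflect-balanced : ∀ {f} → IsPeriodicBijection f → Balanced f → Balanced (reflect f)
  reflect-balanced {f} F balanced = begin
    sumℤ (λ k → - f (- rep k))              ≡⟨ sumℤ-cong (λ k → cong (λ t → - f t) (l₁ (rep k) (+ toℕ k) (rep≡1+ k))) ⟩
    sumℤ (λ k → - f (window (- 1ℤ) k))      ≡⟨ sumℤ-neg (f ∘ window (- 1ℤ)) ⟩
    - sumℤ (f ∘ window (- 1ℤ))              ≡⟨ cong -_ (balanced-window F balanced (- 1ℤ)) ⟩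
    - sumℤ (window (- 1ℤ))                  ≡⟨ sumℤ-neg (window (- 1ℤ)) ⟨
    sumℤ (λ k → - window (- 1ℤ) k)          ≡⟨ sumℤ-cong (λ k → l₂ (rep k) (+ toℕ k) (rep≡1+ k)) ⟩
    sumℤ rep                                ∎
    where
    open ≡-Reasoning
    l₁ : ∀ r t → r ≡ 1ℤ + t → - r ≡ - 1ℤ - t
    l₁ r t refl = solve (t ∷ [])
    l₂ : ∀ r t → r ≡ 1ℤ + t → - (- 1ℤ - t) ≡ r
    l₂ r t refl = solve (t ∷ [])

  inversion∧b≤fb⇒321 : ∀ {f} → IsPeriodicBijection f → Balanced f → ∀ a b → a < b → f b < f a → b ≤ f b → Has321 f
  inversion∧b≤fb⇒321 {f} F balanced a b a<b fb<fa b≤fb = Has321-reflect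
    (inversion∧fa≤a⇒321 (reflect-isPB F) (reflect-balanced F balanced) (- b) (- a) (ℤₚ.neg-mono-< a<b)
      (subst₂ (λ u v → - f u < - f v) (sym (ℤₚ.neg-involutive a)) (sym (ℤₚ.neg-involutive b)) (ℤₚ.neg-mono-< fb<fa))
      (subst (λ u → - f u ≤ - b) (sym (ℤₚ.neg-involutive b)) (ℤₚ.neg-mono-≤ b≤fb)))

  avoids321⇒a<fa∧fb<b : ∀ {f} → IsPeriodicBijection f → Balanced f → ¬ Has321 f →
                               ∀ a b → a < b → f b < f a → a < f a × f b < b
  avoids321⇒a<fa∧fb<b {f} F balanced no321 a b a<b fb<fa = a<fa , fb<b
    where
    a<fa : a < f a
    a<fa = ℤₚ.≰⇒> (λ fa≤a → no321 (inversion∧fa≤a⇒321 F balanced a b a<b fb<fa fa≤a))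
    fb<b : f b < b
    fb<b = ℤₚ.≰⇒> (λ b≤fb → no321 (inversion∧b≤fb⇒321 F balanced a b a<b fb<fa b≤fb))

  ≡ₙ-values-ordered : ∀ {f} → IsPeriodicBijection f → ∀ {x y} → x < y → f y ≡ₙ f x → f x < f y
  ≡ₙ-values-ordered {f} F {x} {y} x<y (q , fy≡fx+qN) = <-by-diff 0<qN (trans (cong (_- f x) fy≡fx+qN) (l (f x) q N))
    where
    open IsPeriodicBijection F
    l : ∀ a q N → a + q * N - a ≡ q * N - 0ℤ
    l = solve-∀
    y≡x+qN : y ≡ x + q * N
    y≡x+qN = injective (trans fy≡fx+qN (sym (periodic-* x q)))
    0<qN : 0ℤ < q * N
    0<qN = <-by-diff x<y (trans (sym (l x q N)) (cong (_- x) (sym y≡x+qN)))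

  affPerm-isPB : (w : AffPerm n) → IsPeriodicBijection (AffPerm.fun w)
  affPerm-isPB w = record
    { inv      = λ y → proj₁ (surjective y)
    ; inv-f    = λ x → injective _ _ (proj₂ (surjective (fun x)))
    ; f-inv    = λ y → proj₂ (surjective y)
    ; periodic = periodic
    }
    where open AffPerm w

  CondII⇒avoids321 : ∀ w → CondII n w → ¬ Has321 (AffPerm.fun w)
  CondII⇒avoids321 w condII (a , b , c , a<b , b<c , fb<fa , fc<fb) =
    ℤₚ.<-asym (proj₂ (condII a b a<b fb<fa)) (proj₁ (condII b c b<c fc<fb))

  avoids321⇒CondII : ∀ w → ¬ Has321 (AffPerm.fun w) → CondII n w
  avoids321⇒CondII w = avoids321⇒a<fa∧fb<b (affPerm-isPB w) (AffPerm.sumCond w)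

  infix 4 _≋_
  _≋_ : Vect n → Vect n → Set
  _≋_ = _≈_ n

  ≋-refl : ∀ {v} → v ≋ v
  ≋-refl = (λ _ → refl) , refl

  ≋-sym : ∀ {v v'} → v ≋ v' → v' ≋ v
  ≋-sym (ε≡ , δ≡) = (λ m → sym (ε≡ m)) , sym δ≡

  ≋-trans : ∀ {u v w} → u ≋ v → v ≋ w → u ≋ w
  ≋-trans (ε≡ , δ≡) (ε≡′ , δ≡′) = (λ m → trans (ε≡ m) (ε≡′ m)) , trans δ≡ δ≡′

  ⊖-cong : ∀ {v v'} → v ≋ v' → ⊖_ n v ≋ ⊖_ n v'
  ⊖-cong (ε≡ , δ≡) = (λ m → cong -_ (ε≡ m)) , cong -_ δ≡

  PositiveRoot-resp : ∀ {v v'} → v' ≋ v → PositiveRoot n v → PositiveRoot n v'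
  PositiveRoot-resp v'≋v (i , j , k , i≢j , k-cond , v≋) = i , j , k , i≢j , k-cond , ≋-trans v'≋v v≋

  NegativeRoot-resp : ∀ {v v'} → v' ≋ v → NegativeRoot n v → NegativeRoot n v'
  NegativeRoot-resp = PositiveRoot-resp ∘ ⊖-cong

  kron-self : ∀ i → kron n i i ≡ 1ℤ
  kron-self i with i Fin.≟ i
  ... | yes _   = refl
  ... | no  i≢i = ⊥-elim (i≢i refl)

  kron-≢ : ∀ {i j} → i ≢ j → kron n i j ≡ 0ℤ
  kron-≢ {i} {j} i≢j with i Fin.≟ j
  ... | yes i≡j = ⊥-elim (i≢j i≡j)
  ... | no  _   = refl

  kron-difference≡1 : ∀ {m a b} → kron n m a - kron n m b ≡ 1ℤ → m ≡ a
  kron-difference≡1 {m} {a} {b} eq with m Fin.≟ a | m Fin.≟ b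
  ... | yes m≡a | _     = m≡a
  ... | no  _   | yes _ = ⊥-elim (ℤₚ.<⇒≢ (ℤ.-<+ {0} {1}) eq)
  ... | no  _   | no  _ = ⊥-elim (ℤₚ.<⇒≢ (ℤ.+<+ (ℕ.s≤s ℕ.z≤n)) eq)

  kron-difference≡-1 : ∀ {m a b} → kron n m a - kron n m b ≡ - 1ℤ → m ≡ b
  kron-difference≡-1 {m} {a} {b} eq with m Fin.≟ a | m Fin.≟ b
  ... | _       | yes m≡b = m≡b
  ... | yes _   | no  _   = ⊥-elim (ℤₚ.<⇒≢ (ℤ.-<+ {0} {1}) (sym eq))
  ... | no  _   | no  _   = ⊥-elim (ℤₚ.<⇒≢ (ℤ.-<+ {0} {0}) (sym eq))

  sum-kron : ∀ (g : Fin n → ℤ) i → sumℤ (λ t → kron n t i * g t) ≡ g i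
  sum-kron g i = begin
    sumℤ (λ t → kron n t i * g t)                   ≡⟨ sumℤ-update (λ t → kron n t i * g t) (λ _ → 0ℤ) i off-i ⟩
    sumℤ {n} (λ _ → 0ℤ) + (kron n i i * g i - 0ℤ)   ≡⟨ cong₂ (λ u v → u + (v * g i - 0ℤ)) Σ0≡0 (kron-self i) ⟩
    0ℤ + (1ℤ * g i - 0ℤ)                            ≡⟨ l (g i) ⟩
    g i                                             ∎
    where
    open ≡-Reasoning
    Σ0≡0 : sumℤ {n} (λ _ → 0ℤ) ≡ 0ℤ
    Σ0≡0 = trans (sumℤ-const {n} 0ℤ) (ℤₚ.*-zeroʳ N)
    off-i : ∀ t → t ≢ i → kron n t i * g t ≡ 0ℤ
    off-i t t≢i = trans (cong (_* g t) (kron-≢ t≢i)) (ℤₚ.*-zeroˡ (g t))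
    l : ∀ x → 0ℤ + (1ℤ * x - 0ℤ) ≡ x
    l = solve-∀

  sum-kron-difference : ∀ (g : Fin n → ℤ) i j → sumℤ (λ t → (kron n t i - kron n t j) * g t) ≡ g i - g j
  sum-kron-difference g i j = begin
    sumℤ (λ t → (kron n t i - kron n t j) * g t)
      ≡⟨ sumℤ-cong (λ t → l (kron n t i) (kron n t j) (g t)) ⟩
    sumℤ (λ t → kron n t i * g t + - (kron n t j * g t))
      ≡⟨ sumℤ-+ (λ t → kron n t i * g t) (λ t → - (kron n t j * g t)) ⟩
    sumℤ (λ t → kron n t i * g t) + sumℤ (λ t → - (kron n t j * g t))
      ≡⟨ cong₂ _+_ (sum-kron g i) (trans (sumℤ-neg (λ t → kron n t j * g t)) (cong -_ (sum-kron g j))) ⟩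
    g i - g j ∎
    where
    open ≡-Reasoning
    l : ∀ a b x → (a - b) * x ≡ a * x + - (b * x)
    l = solve-∀

  -- The root e(x) - e(y), with e as in the definition of act.
  root : ℤ → ℤ → Vect n
  root x y = (λ m → kron n m (residue n x) - kron n m (residue n y)) , block y - block x

  ⊖-root : ∀ x y → ⊖_ n (root x y) ≋ root y x
  ⊖-root x y = (λ m → l (kron n m (residue n x)) (kron n m (residue n y))) , l (block y) (block x)
    where
    l : ∀ a b → - (a - b) ≡ b - a
    l = solve-∀

  root-⊕ : ∀ a b c → _⊕_ n (root a b) (root b c) ≋ root a c
  root-⊕ a b c = (λ m → l (kron n m (residue n a)) (kron n m (residue n b)) (kron n m (residue n c)))
               , trans (ℤₚ.+-comm (block b - block a) (block c - block b)) (l (block c) (block b) (block a))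
    where
    l : ∀ x y z → x - y + (y - z) ≡ x - z
    l = solve-∀

  root-positive : ∀ {x y} → x < y → ¬ x ≡ₙ y → PositiveRoot n (root x y)
  root-positive {x} {y} x<y x≢ₙy = residue n x , residue n y , block y - block x ,
    x≢ₙy ∘ residue≡⇒≡ₙ , positivity (ℤₚ.<-cmp (block y - block x) 0ℤ) , ≋-refl
    where
    rx ry : Fin n
    rx = residue n x
    ry = residue n y
    x≡ : x ≡ rep rx + block x * N
    x≡ = rep-residue-block x
    y≡ : y ≡ rep ry + block y * N
    y≡ = rep-residue-block y
    positivity : Tri _ _ _ → block y - block x > 0ℤ ⊎ (block y - block x ≡ 0ℤ × rx Fin.< ry)
    positivity (tri> _ _ 0<k) = inj₁ 0<k
    positivity (tri< k<0 _ _) = ⊥-elim (ℤₚ.<-asym x<y (<-by-diff₂ (rep<rep+N rx ry)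
      (ℤₚ.*-monoʳ-≤-nonNeg N (k≤-1 k<0)) (trans (cong₂ _-_ x≡ y≡) (l (rep rx) (rep ry) (block x) (block y) N))))
      where
      k≤-1 : ∀ {k} → k < 0ℤ → k ≤ - 1ℤ
      k≤-1 {k} k<0 = <⇒≤-1 {y = 0ℤ} k<0
      l : ∀ a b p q N → a + p * N - (b + q * N) ≡ (a + N - b) + (- 1ℤ * N - (q - p) * N)
      l = solve-∀
    positivity (tri≈ _ k≡0 _) with Finₚ.<-cmp rx ry
    ... | tri< rx<ry _ _ = inj₂ (k≡0 , rx<ry)
    ... | tri≈ _ rx≡ry _ = ⊥-elim (x≢ₙy (residue≡⇒≡ₙ rx≡ry))
    ... | tri> _ _ ry<rx = ⊥-elim (ℤₚ.<-asym x<y (<-by-diff (rep<rep ry<rx)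
      (trans (cong₂ _-_ x≡ y≡) (trans (l (rep rx) (rep ry) (block x) (block y) N)
        (trans (cong (λ k → rep rx - rep ry - k * N) k≡0) (ℤₚ.+-identityʳ (rep rx - rep ry)))))))
      where
      l : ∀ a b p q N → a + p * N - (b + q * N) ≡ a - b - (q - p) * N
      l = solve-∀

  root-negative : ∀ {x y} → y < x → ¬ x ≡ₙ y → NegativeRoot n (root x y)
  root-negative {x} {y} y<x x≢ₙy = PositiveRoot-resp (⊖-root x y) (root-positive y<x (x≢ₙy ∘ ≡ₙ-sym))

  positive⇒root : ∀ {v} → PositiveRoot n v → ∃[ x ] ∃[ y ] x < y × ¬ x ≡ₙ y × v ≋ root x y
  positive⇒root (i , j , k , i≢j , k-cond , v≋) = rep i , rep j + k * N , ordered k-cond , i≢j ∘ separated ,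
    ≋-trans v≋ ((λ m → cong₂ (λ a b → kron n m a - kron n m b) (sym (residue-rep i)) (sym (residue-rep+*N j k)))
               , sym (trans (cong₂ _-_ (block-rep+*N j k) (block-rep i)) (ℤₚ.+-identityʳ k)))
    where
    separated : rep i ≡ₙ rep j + k * N → i ≡ j
    separated i≡ₙ = rep-injectiveₙ (≡ₙ-trans i≡ₙ (+*N-≡ₙ (rep j) k))
    ordered : k > 0ℤ ⊎ (k ≡ 0ℤ × i Fin.< j) → rep i < rep j + k * N
    ordered (inj₁ 0<k)          = ℤₚ.<-≤-trans (rep<rep+N j i) (ℤₚ.+-monoʳ-≤ (rep j) (N≤*N 0<k))
    ordered (inj₂ (refl , i<j)) = subst (rep i <_) (sym (ℤₚ.+-identityʳ (rep j))) (rep<rep i<j)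

  negative-root-order : ∀ {v x y} → v ≋ root x y → ¬ x ≡ₙ y → NegativeRoot n v → y < x
  negative-root-order {v} {x} {y} v≋ x≢ₙy (i , j , k , _ , k-cond , -v≋) = ordered k-cond
    where
    rx ry : Fin n
    rx = residue n x
    ry = residue n y
    root-yx≋ : root y x ≋ rootVec n i j k
    root-yx≋ = ≋-trans (≋-sym (⊖-root x y)) (≋-trans (⊖-cong (≋-sym v≋)) -v≋)
    ry≡i : ry ≡ i
    ry≡i = kron-difference≡1 (trans (sym (proj₁ root-yx≋ ry))
                                    (cong₂ _-_ (kron-self ry) (kron-≢ (x≢ₙy ∘ ≡ₙ-sym ∘ residue≡⇒≡ₙ))))
    rx≡j : rx ≡ j
    rx≡j = kron-difference≡-1 (trans (sym (proj₁ root-yx≋ rx))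
                                     (cong₂ _-_ (kron-≢ (x≢ₙy ∘ residue≡⇒≡ₙ)) (kron-self rx)))
    x-y≡ : x - y ≡ rep rx - rep ry + k * N
    x-y≡ = trans (cong₂ _-_ (rep-residue-block x) (rep-residue-block y))
                 (trans (l (rep rx) (rep ry) (block x) (block y) N) (cong (λ t → rep rx - rep ry + t * N) (proj₂ root-yx≋)))
      where
      l : ∀ a b p q N → a + p * N - (b + q * N) ≡ a - b + (p - q) * N
      l = solve-∀
    ordered : k > 0ℤ ⊎ (k ≡ 0ℤ × i Fin.< j) → y < x
    ordered (inj₁ 0<k) = <-by-diff₂ (rep<rep+N rx ry) (N≤*N 0<k) (trans x-y≡ (l (rep rx) (rep ry) k N))
      where
      l : ∀ a b k N → a - b + k * N ≡ (a + N - b) + (k * N - N)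
      l = solve-∀
    ordered (inj₂ (refl , i<j)) = <-by-diff (rep<rep (subst₂ Fin._<_ (sym ry≡i) (sym rx≡j) i<j))
                                            (trans x-y≡ (ℤₚ.+-identityʳ (rep rx - rep ry)))

  kron-difference≢2 : ∀ {m a b} → kron n m a - kron n m b ≢ + 2
  kron-difference≢2 {m} {a} {b} eq with m Fin.≟ a | m Fin.≟ b
  ... | yes _ | yes _ = ℤₚ.<⇒≢ (ℤ.+<+ (ℕ.s≤s ℕ.z≤n)) eq
  ... | yes _ | no  _ = ℤₚ.<⇒≢ (ℤ.+<+ (ℕ.s≤s (ℕ.s≤s ℕ.z≤n))) eq
  ... | no  _ | yes _ = ℤₚ.<⇒≢ (ℤ.-<+ {0} {2}) eq
  ... | no  _ | no  _ = ℤₚ.<⇒≢ (ℤ.+<+ (ℕ.s≤s ℕ.z≤n)) eq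

  kron-sum-chained : ∀ a b c d i j → a ≢ b → c ≢ d →
                     (∀ m → kron n m a - kron n m b + (kron n m c - kron n m d) ≡ kron n m i - kron n m j) →
                     b ≡ c ⊎ d ≡ a
  kron-sum-chained a b c d i j a≢b c≢d sum≡ with b Fin.≟ c | d Fin.≟ a
  ... | yes b≡c | _       = inj₁ b≡c
  ... | no  _   | yes d≡a = inj₂ d≡a
  ... | no  b≢c | no  d≢a with a Fin.≟ c
  ...   | yes refl = ⊥-elim (kron-difference≢2 {a} {i} {j} (trans (sym (sum≡ a)) at-a))
    where
    at-a : kron n a a - kron n a b + (kron n a a - kron n a d) ≡ + 2
    at-a rewrite kron-self a | kron-≢ a≢b | kron-≢ (d≢a ∘ sym) = refl
  ...   | no  a≢c = ⊥-elim (a≢c (trans (kron-difference≡1 (trans (sym (sum≡ a)) at-a))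
                                       (sym (kron-difference≡1 (trans (sym (sum≡ c)) at-c)))))
    where
    at-a : kron n a a - kron n a b + (kron n a c - kron n a d) ≡ 1ℤ
    at-a rewrite kron-self a | kron-≢ a≢b | kron-≢ a≢c | kron-≢ (d≢a ∘ sym) = refl
    at-c : kron n c a - kron n c b + (kron n c c - kron n c d) ≡ 1ℤ
    at-c rewrite kron-self c | kron-≢ (a≢c ∘ sym) | kron-≢ (b≢c ∘ sym) | kron-≢ c≢d = refl

  module _ (w : AffPerm n) where
    private
      f : ℤ → ℤ
      f = AffPerm.fun w
      F : IsPeriodicBijection f
      F = affPerm-isPB w

    act-cong : ∀ {v v'} → v ≋ v' → act n w v ≋ act n w v'
    act-cong (ε≡ , δ≡) =
        (λ m → sumℤ-cong (λ i → cong (_* kron n m (residue n (f (rep i)))) (ε≡ i)))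
      , cong₂ _-_ δ≡ (sumℤ-cong (λ i → cong (_* block (f (rep i))) (ε≡ i)))

    act-root : ∀ x y → act n w (root x y) ≋ root (f x) (f y)
    act-root x y =
        (λ m → trans (sum-kron-difference (λ t → kron n m (residue n (f (rep t)))) rx ry)
                     (cong₂ (λ a b → kron n m a - kron n m b) (residue-f x) (residue-f y)))
      , (begin
          block y - block x - sumℤ (λ t → (kron n t rx - kron n t ry) * block (f (rep t)))
            ≡⟨ cong (λ t → block y - block x - t) (sum-kron-difference (λ t → block (f (rep t))) rx ry) ⟩
          block y - block x - (block (f (rep rx)) - block (f (rep ry)))
            ≡⟨ l (block x) (block y) (block (f (rep rx))) (block (f (rep ry))) ⟩
          (block (f (rep ry)) + block y) - (block (f (rep rx)) + block x)
            ≡⟨ cong₂ _-_ (block-f y) (block-f x) ⟨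
          block (f y) - block (f x) ∎)
      where
      open ≡-Reasoning
      rx ry : Fin n
      rx = residue n x
      ry = residue n y
      l : ∀ bx by ax ay → by - bx - (ax - ay) ≡ (ay + by) - (ax + bx)
      l = solve-∀
      residue-f : ∀ z → residue n (f (rep (residue n z))) ≡ residue n (f z)
      residue-f z = ≡ₙ⇒residue≡ (PB.≡ₙ-map F (≡ₙ-sym (≡ₙ-rep-residue z)))
      block-f : ∀ z → block (f z) ≡ block (f (rep (residue n z))) + block z
      block-f z = begin
        block (f z)                           ≡⟨ cong (λ t → block (f t)) (rep-residue-block z) ⟩
        block (f (r + block z * N))           ≡⟨ cong (λ t → (t - 1ℤ) /ℕ n) (PB.periodic-* F r (block z)) ⟩
        (f r + block z * N - 1ℤ) /ℕ n         ≡⟨ cong (_/ℕ n) (l′ (f r) (block z) N) ⟩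
        (f r - 1ℤ + block z * N) /ℕ n         ≡⟨ proj₂ (+*N-divmod (f r - 1ℤ) (block z)) ⟩
        block (f r) + block z                 ∎
        where
        r : ℤ
        r = rep (residue n z)
        l′ : ∀ a q N → a + q * N - 1ℤ ≡ a - 1ℤ + q * N
        l′ = solve-∀

    inverted-pair-separated : ∀ {a b} → a < b → f b < f a → ¬ a ≡ₙ b
    inverted-pair-separated a<b fb<fa a≡ₙb = ℤₚ.<-asym fb<fa (≡ₙ-values-ordered F a<b (PB.≡ₙ-map F (≡ₙ-sym a≡ₙb)))

    InvertedRoot : Vect n → Set
    InvertedRoot v = ∃[ x ] ∃[ y ] x < y × f y < f x × ¬ x ≡ₙ y × v ≋ root x y

    inverted-root : ∀ {v} → PositiveRoot n v → NegativeRoot n (act n w v) → InvertedRoot v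
    inverted-root {v} v⁺ wv⁻ = invert (positive⇒root v⁺)
      where
      invert : (∃[ x ] ∃[ y ] x < y × ¬ x ≡ₙ y × v ≋ root x y) → InvertedRoot v
      invert (x , y , x<y , x≢ₙy , v≋) =
        x , y , x<y , negative-root-order (≋-trans (act-cong v≋) (act-root x y)) (x≢ₙy ∘ PB.≡ₙ-unmap F) wv⁻ , x≢ₙy , v≋

    chained-inversions⇒321 : ∀ {x₁ y₁ x₂ y₂} → x₁ < y₁ → f y₁ < f x₁ → x₂ < y₂ → f y₂ < f x₂ → y₁ ≡ₙ x₂ → Has321 f
    chained-inversions⇒321 {x₁} {y₁} {x₂} {y₂} x₁<y₁ fy₁<fx₁ x₂<y₂ fy₂<fx₂ (q , refl) =
      x₁ , x₂ + q * N , y₂ + q * N , x₁<y₁ , ℤₚ.+-monoˡ-< (q * N) x₂<y₂ , fy₁<fx₁ ,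
      subst₂ _<_ (sym (PB.periodic-* F y₂ q)) (sym (PB.periodic-* F x₂ q)) (ℤₚ.+-monoˡ-< (q * N) fy₂<fx₂)

    inverted-roots⇒321 : ∀ {α β} → InvertedRoot α → InvertedRoot β → PositiveRoot n (_⊕_ n α β) → Has321 f
    inverted-roots⇒321 (x₁ , y₁ , x₁<y₁ , fy₁<fx₁ , x₁≢ₙy₁ , α≋) (x₂ , y₂ , x₂<y₂ , fy₂<fx₂ , x₂≢ₙy₂ , β≋)
                       (i , j , _ , _ , _ , α⊕β≋) =
      [ (λ y₁~x₂ → chained-inversions⇒321 x₁<y₁ fy₁<fx₁ x₂<y₂ fy₂<fx₂ (residue≡⇒≡ₙ y₁~x₂))
      , (λ y₂~x₁ → chained-inversions⇒321 x₂<y₂ fy₂<fx₂ x₁<y₁ fy₁<fx₁ (residue≡⇒≡ₙ y₂~x₁))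
      ]′ (kron-sum-chained (residue n x₁) (residue n y₁) (residue n x₂) (residue n y₂) i j
            (x₁≢ₙy₁ ∘ residue≡⇒≡ₙ) (x₂≢ₙy₂ ∘ residue≡⇒≡ₙ)
            (λ m → trans (sym (cong₂ _+_ (proj₁ α≋ m) (proj₁ β≋ m))) (proj₁ α⊕β≋ m)))

    avoids321⇒CondIV : ¬ Has321 f → CondIV n w
    avoids321⇒CondIV no321 (α , β , α⁺ , β⁺ , α⊕β⁺ , wα⁻ , wβ⁻) =
      no321 (inverted-roots⇒321 (inverted-root α⁺ wα⁻) (inverted-root β⁺ wβ⁻) α⊕β⁺)

    CondIV⇒avoids321 : CondIV n w → ¬ Has321 f
    CondIV⇒avoids321 condIV (a , b , c , a<b , b<c , fb<fa , fc<fb) = condIV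
      ( root a b , root b c
      , root-positive a<b a≢ₙb , root-positive b<c b≢ₙc
      , PositiveRoot-resp (root-⊕ a b c) (root-positive a<c (inverted-pair-separated a<c (ℤₚ.<-trans fc<fb fb<fa)))
      , NegativeRoot-resp (act-root a b) (root-negative fb<fa (a≢ₙb ∘ PB.≡ₙ-unmap F))
      , NegativeRoot-resp (act-root b c) (root-negative fc<fb (b≢ₙc ∘ PB.≡ₙ-unmap F)))
      where
      a<c : a < c
      a<c = ℤₚ.<-trans a<b b<c
      a≢ₙb : ¬ a ≡ₙ b
      a≢ₙb = inverted-pair-separated a<b fb<fa
      b≢ₙc : ¬ b ≡ₙ c
      b≢ₙc = inverted-pair-separated b<c fc<fb

  module _ (3≤n : 3 ℕ.≤ n) where

    x+1≢ₙx : ∀ x → ¬ (x + 1ℤ ≡ₙ x)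
    x+1≢ₙx x = x+k≢ₙx x 1 (ℕ.s≤s ℕ.z≤n) (ℕₚ.<-≤-trans (ℕ.s≤s (ℕ.s≤s ℕ.z≤n)) 3≤n)

    x+2≢ₙx : ∀ x → ¬ (x + + 2 ≡ₙ x)
    x+2≢ₙx x = x+k≢ₙx x 2 (ℕ.s≤s ℕ.z≤n) 3≤n

    -- Abstract, so that proofs go through the three cases below instead of unfolding sgen.
    abstract
      s : ℤ → ℤ → ℤ
      s = sgen n

      gen≡s : ∀ k x → gen n k x ≡ s (rep k) x
      gen≡s k x = refl

      s-at-c : ∀ {c x} → x ≡ₙ c → s c x ≡ x + 1ℤ
      s-at-c {c} {x} x≡ₙc with (x - c) %ℕ n | ≡ₙ⇒-%ℕ≡0 x c x≡ₙc
      ... | .0 | refl = refl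

      s-at-c+1 : ∀ {c x} → x ≡ₙ c + 1ℤ → s c x ≡ x - 1ℤ
      s-at-c+1 {c} {x} x≡ₙc+1 with (x - c) %ℕ n in eq | (x - (c + 1ℤ)) %ℕ n | ≡ₙ⇒-%ℕ≡0 x (c + 1ℤ) x≡ₙc+1
      ... | zero  | _  | _    = ⊥-elim (x+1≢ₙx c (≡ₙ-trans (≡ₙ-sym x≡ₙc+1) (-%ℕ≡0⇒≡ₙ x c eq)))
      ... | suc _ | .0 | refl = refl

      s-elsewhere : ∀ {c x} → ¬ x ≡ₙ c → ¬ x ≡ₙ c + 1ℤ → s c x ≡ x
      s-elsewhere {c} {x} x≢ₙc x≢ₙc+1 with (x - c) %ℕ n in eq₀ | (x - (c + 1ℤ)) %ℕ n in eq₁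
      ... | zero  | _     = ⊥-elim (x≢ₙc (-%ℕ≡0⇒≡ₙ x c eq₀))
      ... | suc _ | zero  = ⊥-elim (x≢ₙc+1 (-%ℕ≡0⇒≡ₙ x (c + 1ℤ) eq₁))
      ... | suc _ | suc _ = refl

    data Position (c x : ℤ) : Set where
      at-c      : x ≡ₙ c → Position c x
      at-c+1    : x ≡ₙ c + 1ℤ → Position c x
      elsewhere : ¬ x ≡ₙ c → ¬ x ≡ₙ c + 1ℤ → Position c x

    position : ∀ c x → Position c x
    position c x with x ≡ₙ? c | x ≡ₙ? (c + 1ℤ)
    ... | yes x≡ₙc | _           = at-c x≡ₙc
    ... | no x≢ₙc  | yes x≡ₙc+1  = at-c+1 x≡ₙc+1
    ... | no x≢ₙc  | no x≢ₙc+1   = elsewhere x≢ₙc x≢ₙc+1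

    s-periodic : ∀ c x q → s c (x + q * N) ≡ s c x + q * N
    s-periodic c x q with position c x
    ... | at-c x≡ₙc = begin
      s c (x + q * N)   ≡⟨ s-at-c (≡ₙ-trans (+*N-≡ₙ x q) x≡ₙc) ⟩
      x + q * N + 1ℤ    ≡⟨ l x q N ⟩
      x + 1ℤ + q * N    ≡⟨ cong (_+ q * N) (s-at-c x≡ₙc) ⟨
      s c x + q * N     ∎
      where
      open ≡-Reasoning
      l : ∀ x q N → x + q * N + 1ℤ ≡ x + 1ℤ + q * N
      l = solve-∀
    ... | at-c+1 x≡ₙc+1 = begin
      s c (x + q * N)   ≡⟨ s-at-c+1 (≡ₙ-trans (+*N-≡ₙ x q) x≡ₙc+1) ⟩
      x + q * N - 1ℤ    ≡⟨ l x q N ⟩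
      x - 1ℤ + q * N    ≡⟨ cong (_+ q * N) (s-at-c+1 x≡ₙc+1) ⟨
      s c x + q * N     ∎
      where
      open ≡-Reasoning
      l : ∀ x q N → x + q * N - 1ℤ ≡ x - 1ℤ + q * N
      l = solve-∀
    ... | elsewhere x≢ₙc x≢ₙc+1 =
      trans (s-elsewhere (x≢ₙc ∘ ≡ₙ-trans (≡ₙ-sym (+*N-≡ₙ x q))) (x≢ₙc+1 ∘ ≡ₙ-trans (≡ₙ-sym (+*N-≡ₙ x q))))
            (cong (_+ q * N) (sym (s-elsewhere x≢ₙc x≢ₙc+1)))

    s-cong : ∀ {c c'} x → c ≡ₙ c' → s c x ≡ s c' x
    s-cong {c} {c'} x c≡ₙc' with position c x
    ... | at-c x≡ₙc = trans (s-at-c x≡ₙc) (sym (s-at-c (≡ₙ-trans x≡ₙc c≡ₙc')))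
    ... | at-c+1 x≡ₙc+1 = trans (s-at-c+1 x≡ₙc+1) (sym (s-at-c+1 (≡ₙ-trans x≡ₙc+1 (≡ₙ-+ʳ 1ℤ c≡ₙc'))))
    ... | elsewhere x≢ₙc x≢ₙc+1 = trans (s-elsewhere x≢ₙc x≢ₙc+1)
      (sym (s-elsewhere (λ x≡ₙc' → x≢ₙc (≡ₙ-trans x≡ₙc' (≡ₙ-sym c≡ₙc')))
                        (λ x≡ₙc'+1 → x≢ₙc+1 (≡ₙ-trans x≡ₙc'+1 (≡ₙ-sym (≡ₙ-+ʳ 1ℤ c≡ₙc'))))))

    s-involutive : ∀ c x → s c (s c x) ≡ x
    s-involutive c x with position c x
    ... | at-c x≡ₙc = begin
      s c (s c x)     ≡⟨ cong (s c) (s-at-c x≡ₙc) ⟩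
      s c (x + 1ℤ)    ≡⟨ s-at-c+1 (≡ₙ-+ʳ 1ℤ x≡ₙc) ⟩
      x + 1ℤ - 1ℤ     ≡⟨ i+1-1≡i x ⟩
      x               ∎
      where open ≡-Reasoning
    ... | at-c+1 x≡ₙc+1 = begin
      s c (s c x)     ≡⟨ cong (s c) (s-at-c+1 x≡ₙc+1) ⟩
      s c (x - 1ℤ)    ≡⟨ s-at-c (≡ₙ-+ʳ⁻¹ 1ℤ (subst (_≡ₙ c + 1ℤ) (sym (i-1+1≡i x)) x≡ₙc+1)) ⟩
      x - 1ℤ + 1ℤ     ≡⟨ i-1+1≡i x ⟩
      x               ∎
      where open ≡-Reasoning
    ... | elsewhere x≢ₙc x≢ₙc+1 = trans (cong (s c) (s-elsewhere x≢ₙc x≢ₙc+1)) (s-elsewhere x≢ₙc x≢ₙc+1)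

    s-lower : ∀ c x → x - 1ℤ ≤ s c x
    s-lower c x with position c x
    ... | at-c x≡ₙc = subst (x - 1ℤ ≤_) (sym (s-at-c x≡ₙc)) (ℤₚ.<⇒≤ (ℤₚ.<-trans (i-1<i x) (i<i+1 x)))
    ... | at-c+1 x≡ₙc+1 = ℤₚ.≤-reflexive (sym (s-at-c+1 x≡ₙc+1))
    ... | elsewhere x≢ₙc x≢ₙc+1 = subst (x - 1ℤ ≤_) (sym (s-elsewhere x≢ₙc x≢ₙc+1)) (ℤₚ.<⇒≤ (i-1<i x))

    s-mono-< : ∀ c {x y} → x < y → ¬ (x ≡ₙ c × y ≡ x + 1ℤ) → s c x < s c y
    s-mono-< c {x} {y} x<y exception with position c x | position c y
    ... | at-c+1 x≡ₙc+1 | _ = begin-strict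
      s c x    ≡⟨ s-at-c+1 x≡ₙc+1 ⟩
      x - 1ℤ   <⟨ i-1<i x ⟩
      x        ≤⟨ <⇒≤-1 x<y ⟩
      y - 1ℤ   ≤⟨ s-lower c y ⟩
      s c y    ∎
      where open ℤₚ.≤-Reasoning
    ... | at-c x≡ₙc | at-c y≡ₙc = begin-strict
      s c x    ≡⟨ s-at-c x≡ₙc ⟩
      x + 1ℤ   <⟨ ℤₚ.+-monoˡ-< 1ℤ x<y ⟩
      y + 1ℤ   ≡⟨ s-at-c y≡ₙc ⟨
      s c y    ∎
      where open ℤₚ.≤-Reasoning
    ... | at-c x≡ₙc | at-c+1 y≡ₙc+1 = begin-strict
      s c x              ≡⟨ s-at-c x≡ₙc ⟩
      x + 1ℤ             <⟨ <-by-diff (ℤₚ.<-≤-trans (ℤ.+<+ (ℕ.s≤s (ℕ.s≤s ℕ.z≤n))) (ℤ.+≤+ 3≤n)) (l x N) ⟩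
      x + 1ℤ + N - 1ℤ    ≤⟨ ℤₚ.+-monoˡ-≤ (- 1ℤ) (≡ₙ-gap y≡ₙx+1 (<∧≢⇒+1< x<y (λ y≡x+1 → exception (x≡ₙc , y≡x+1)))) ⟩
      y - 1ℤ             ≡⟨ s-at-c+1 y≡ₙc+1 ⟨
      s c y              ∎
      where
      open ℤₚ.≤-Reasoning
      l : ∀ x N → x + 1ℤ + N - 1ℤ - (x + 1ℤ) ≡ N - 1ℤ
      l = solve-∀
      y≡ₙx+1 : y ≡ₙ x + 1ℤ
      y≡ₙx+1 = ≡ₙ-trans y≡ₙc+1 (≡ₙ-sym (≡ₙ-+ʳ 1ℤ x≡ₙc))
    ... | at-c x≡ₙc | elsewhere y≢ₙc y≢ₙc+1 = begin-strict
      s c x    ≡⟨ s-at-c x≡ₙc ⟩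
      x + 1ℤ   <⟨ <∧≢⇒+1< x<y (λ y≡x+1 → y≢ₙc+1 (subst (_≡ₙ c + 1ℤ) (sym y≡x+1) (≡ₙ-+ʳ 1ℤ x≡ₙc))) ⟩
      y        ≡⟨ s-elsewhere y≢ₙc y≢ₙc+1 ⟨
      s c y    ∎
      where open ℤₚ.≤-Reasoning
    ... | elsewhere x≢ₙc x≢ₙc+1 | at-c+1 y≡ₙc+1 = begin-strict
      s c x    ≡⟨ s-elsewhere x≢ₙc x≢ₙc+1 ⟩
      x        <⟨ <∧≢⇒<-1 x<y (λ y≡x+1 → x≢ₙc (≡ₙ-+ʳ⁻¹ 1ℤ (subst (_≡ₙ c + 1ℤ) y≡x+1 y≡ₙc+1))) ⟩
      y - 1ℤ   ≡⟨ s-at-c+1 y≡ₙc+1 ⟨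
      s c y    ∎
      where open ℤₚ.≤-Reasoning
    ... | elsewhere x≢ₙc x≢ₙc+1 | at-c y≡ₙc = begin-strict
      s c x    ≡⟨ s-elsewhere x≢ₙc x≢ₙc+1 ⟩
      x        <⟨ ℤₚ.<-trans x<y (i<i+1 y) ⟩
      y + 1ℤ   ≡⟨ s-at-c y≡ₙc ⟨
      s c y    ∎
      where open ℤₚ.≤-Reasoning
    ... | elsewhere x≢ₙc x≢ₙc+1 | elsewhere y≢ₙc y≢ₙc+1 =
      subst₂ _<_ (sym (s-elsewhere x≢ₙc x≢ₙc+1)) (sym (s-elsewhere y≢ₙc y≢ₙc+1)) x<y

    s-mono-≤ : ∀ c {x y} → x ≤ y → ¬ (x ≡ₙ c × y ≡ x + 1ℤ) → s c x ≤ s c y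
    s-mono-≤ c {x} {y} x≤y exception with x ℤₚ.≟ y
    ... | yes refl = ℤₚ.≤-refl
    ... | no x≢y   = ℤₚ.<⇒≤ (s-mono-< c (ℤₚ.≤∧≢⇒< x≤y x≢y) exception)

    s-c : ∀ c → s c c ≡ c + 1ℤ
    s-c c = s-at-c ≡ₙ-refl

    s-c+1 : ∀ c → s c (c + 1ℤ) ≡ c
    s-c+1 c = trans (s-at-c+1 ≡ₙ-refl) (i+1-1≡i c)

    s-c+2 : ∀ c → s c (c + 1ℤ + 1ℤ) ≡ c + 1ℤ + 1ℤ
    s-c+2 c = s-elsewhere (x+2≢ₙx c ∘ subst (_≡ₙ c) (l c)) (x+1≢ₙx (c + 1ℤ))
      where
      l : ∀ c → c + 1ℤ + 1ℤ ≡ c + + 2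
      l = solve-∀

    s-c-1 : ∀ c → s c (c - 1ℤ) ≡ c - 1ℤ
    s-c-1 c = s-elsewhere (λ c-1≡ₙc → x+1≢ₙx (c - 1ℤ) (subst (_≡ₙ c - 1ℤ) (sym (i-1+1≡i c)) (≡ₙ-sym c-1≡ₙc)))
                          (λ c-1≡ₙc+1 → x+2≢ₙx (c - 1ℤ) (subst (_≡ₙ c - 1ℤ) (l c) (≡ₙ-sym c-1≡ₙc+1)))
      where
      l : ∀ c → c + 1ℤ ≡ c - 1ℤ + + 2
      l = solve-∀

    s-isPB : ∀ c → IsPeriodicBijection (s c)
    s-isPB c = record
      { inv      = s c
      ; inv-f    = s-involutive c
      ; f-inv    = s-involutive c
      ; periodic = λ x → subst₂ (λ u v → s c u ≡ v) (+1*N x) (+1*N (s c x)) (s-periodic c x 1ℤ)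
      }
      where
      +1*N : ∀ x → x + 1ℤ * N ≡ x + N
      +1*N x = cong (λ t → x + t) (ℤₚ.*-identityˡ N)

    /ℕ-bounds : ∀ d → d /ℕ n * N ≤ d × d < d /ℕ n * N + N
    /ℕ-bounds d = ≤-by-diff {u₁ = 0ℤ} (ℤ.+≤+ ℕ.z≤n) (l₁ d) , <-by-diff (ℤ.+<+ (%ℕ<n d)) (l₂ d)
      where
      l₁ : ∀ d → d - d /ℕ n * N ≡ + (d %ℕ n) - 0ℤ
      l₁ d = begin
        d - d /ℕ n * N                          ≡⟨ cong (_- d /ℕ n * N) (divmod d) ⟩
        + (d %ℕ n) + d /ℕ n * N - d /ℕ n * N    ≡⟨ l (+ (d %ℕ n)) (d /ℕ n * N) ⟩
        + (d %ℕ n) - 0ℤ                         ∎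
        where
        open ≡-Reasoning
        l : ∀ r m → r + m - m ≡ r - 0ℤ
        l = solve-∀
      l₂ : ∀ d → d /ℕ n * N + N - d ≡ N - + (d %ℕ n)
      l₂ d = begin
        d /ℕ n * N + N - d                          ≡⟨ cong (λ t → d /ℕ n * N + N - t) (divmod d) ⟩
        d /ℕ n * N + N - (+ (d %ℕ n) + d /ℕ n * N)  ≡⟨ l (+ (d %ℕ n)) (d /ℕ n * N) N ⟩
        N - + (d %ℕ n)                              ∎
        where
        open ≡-Reasoning
        l : ∀ r m N → m + N - (r + m) ≡ N - r
        l = solve-∀

    1<N : 1ℤ < N
    1<N = ℤ.+<+ (ℕₚ.<-≤-trans (ℕ.s≤s (ℕ.s≤s ℕ.z≤n)) 3≤n)

    /ℕ-one+*N : ∀ D → (1ℤ + D * N) /ℕ n ≡ D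
    /ℕ-one+*N D = /ℕ-between D (1ℤ + D * N) (≤-by-diff {u₁ = 0ℤ} {v₁ = 1ℤ} (ℤ.+≤+ ℕ.z≤n) (l₁ D N))
                                        (<-by-diff 1<N (l₂ D N))
      where
      l₁ : ∀ D N → 1ℤ + D * N - D * N ≡ 1ℤ - 0ℤ
      l₁ = solve-∀
      l₂ : ∀ D N → D * N + N - (1ℤ + D * N) ≡ N - 1ℤ
      l₂ = solve-∀

    /ℕ-minus-one+*N : ∀ D → (- 1ℤ + D * N) /ℕ n ≡ D - 1ℤ
    /ℕ-minus-one+*N D = /ℕ-between (D - 1ℤ) (- 1ℤ + D * N) (≤-by-diff (ℤₚ.<⇒≤ 1<N) (l₁ D N))
                                                  (<-by-diff {u₁ = 0ℤ} {v₁ = 1ℤ} (ℤ.+<+ (ℕ.s≤s ℕ.z≤n)) (l₂ D N))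
      where
      l₁ : ∀ D N → - 1ℤ + D * N - (D - 1ℤ) * N ≡ N - 1ℤ
      l₁ = solve-∀
      l₂ : ∀ D N → (D - 1ℤ) * N + N - (- 1ℤ + D * N) ≡ 1ℤ - 0ℤ
      l₂ = solve-∀

    s-preserves-/ℕ : ∀ c y₁ y₂ → ¬ (y₁ ≡ₙ c × y₂ ≡ₙ c + 1ℤ) → ¬ (y₁ ≡ₙ c + 1ℤ × y₂ ≡ₙ c) →
                     (s c y₂ - s c y₁) /ℕ n ≡ (y₂ - y₁) /ℕ n
    s-preserves-/ℕ c y₁ y₂ exception₁ exception₂ = /ℕ-between m (s c y₂ - s c y₁)
      (≤-by-diff lower (l₁ (s c y₁) (s c y₂) m N)) (<-by-diff upper (l₂ (s c y₁) (s c y₂) m N))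
      where
      m : ℤ
      m = (y₂ - y₁) /ℕ n
      l₁ : ∀ a b m N → b - a - m * N ≡ b - (a + m * N)
      l₁ = solve-∀
      l₂ : ∀ a b m N → m * N + N - (b - a) ≡ a + (m + 1ℤ) * N - b
      l₂ = solve-∀
      y₁+mN≤y₂ : y₁ + m * N ≤ y₂
      y₁+mN≤y₂ = ≤-by-diff (proj₁ (/ℕ-bounds (y₂ - y₁))) (sym (l₁ y₁ y₂ m N))
      y₂<y₁+[m+1]N : y₂ < y₁ + (m + 1ℤ) * N
      y₂<y₁+[m+1]N = <-by-diff (proj₂ (/ℕ-bounds (y₂ - y₁))) (sym (l₂ y₁ y₂ m N))
      lower : s c y₁ + m * N ≤ s c y₂
      lower = subst (_≤ s c y₂) (s-periodic c y₁ m) (s-mono-≤ c y₁+mN≤y₂ λ (y₁+mN≡ₙc , y₂≡y₁+mN+1) →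
        exception₁ ( ≡ₙ-trans (≡ₙ-sym (+*N-≡ₙ y₁ m)) y₁+mN≡ₙc
                   , subst (_≡ₙ c + 1ℤ) (sym y₂≡y₁+mN+1) (≡ₙ-+ʳ 1ℤ y₁+mN≡ₙc)))
      upper : s c y₂ < s c y₁ + (m + 1ℤ) * N
      upper = subst (s c y₂ <_) (s-periodic c y₁ (m + 1ℤ)) (s-mono-< c y₂<y₁+[m+1]N λ (y₂≡ₙc , y₁+[m+1]N≡y₂+1) →
        exception₂ ( ≡ₙ-trans (≡ₙ-sym (+*N-≡ₙ y₁ (m + 1ℤ)))
                       (subst (_≡ₙ c + 1ℤ) (sym y₁+[m+1]N≡y₂+1) (≡ₙ-+ʳ 1ℤ y₂≡ₙc))
                   , y₂≡ₙc))

    -- Only the window positions i₀, j₀ holding the values ≡ c and ≡ c + 1 change their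
    -- inversion count, and it changes by one.
    module Exchange {f} (F : IsPeriodicBijection f) (c : ℤ) where
      open IsPeriodicBijection F

      i₀ j₀ : Fin n
      i₀ = residue n (inv c)
      j₀ = residue n (inv (c + 1ℤ))

      f-i₀ : f (rep i₀) ≡ₙ c
      f-i₀ = - block (inv c) , f-rep-residue c
      f-j₀ : f (rep j₀) ≡ₙ c + 1ℤ
      f-j₀ = - block (inv (c + 1ℤ)) , f-rep-residue (c + 1ℤ)

      only-i₀ : ∀ {i} → f (rep i) ≡ₙ c → i ≡ i₀
      only-i₀ fi≡ₙc = rep-injectiveₙ (≡ₙ-unmap (≡ₙ-trans fi≡ₙc (≡ₙ-sym f-i₀)))
      only-j₀ : ∀ {j} → f (rep j) ≡ₙ c + 1ℤ → j ≡ j₀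
      only-j₀ fj≡ₙc+1 = rep-injectiveₙ (≡ₙ-unmap (≡ₙ-trans fj≡ₙc+1 (≡ₙ-sym f-j₀)))

      i₀≢j₀ : i₀ ≢ j₀
      i₀≢j₀ i₀≡j₀ = x+1≢ₙx c (≡ₙ-trans (≡ₙ-sym f-j₀) (subst (λ k → f (rep k) ≡ₙ c) i₀≡j₀ f-i₀))

      private
        g : ℤ → ℤ
        g = s c ∘ f
        x₀ y₀ : ℤ
        x₀ = block (inv c)
        y₀ = block (inv (c + 1ℤ))

        unchanged : ∀ i j → ¬ (i ≡ i₀ × j ≡ j₀) → ¬ (i ≡ j₀ × j ≡ i₀) → inversions g i j ≡ inversions f i j
        unchanged i j ¬i₀j₀ ¬j₀i₀ = inversions-cong g f i j λ _ → s-preserves-/ℕ c (f (rep i)) (f (rep j))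
          (λ (fi≡ₙc , fj≡ₙc+1) → ¬i₀j₀ (only-i₀ fi≡ₙc , only-j₀ fj≡ₙc+1))
          (λ (fi≡ₙc+1 , fj≡ₙc) → ¬j₀i₀ (only-j₀ fi≡ₙc+1 , only-i₀ fj≡ₙc))

        off-pair : ∀ {a b} → a Fin.< b → (a ≡ i₀ × b ≡ j₀) ⊎ (a ≡ j₀ × b ≡ i₀) →
                   ∀ i j → ¬ (i ≡ a × j ≡ b) → inversions g i j ≡ inversions f i j
        off-pair {a} {b} a<b _ i j _ with (i Fin.≟ b) ×-dec (j Fin.≟ a)
        off-pair a<b _ i j _ | yes (refl , refl) =
          trans (inversions-≮ g (Finₚ.<-asym a<b)) (sym (inversions-≮ f (Finₚ.<-asym a<b)))
        off-pair a<b (inj₁ (refl , refl)) i j ¬ab | no ¬ba = unchanged i j ¬ab ¬ba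
        off-pair a<b (inj₂ (refl , refl)) i j ¬ab | no ¬ba = unchanged i j ¬ba ¬ab

        g-i₀ : g (rep i₀) ≡ f (rep i₀) + 1ℤ
        g-i₀ = s-at-c f-i₀
        g-j₀ : g (rep j₀) ≡ f (rep j₀) - 1ℤ
        g-j₀ = s-at-c+1 f-j₀

        count : ∀ h {a b} → a Fin.< b → ∀ {D} → h (rep b) - h (rep a) ≡ D → inversions h a b ≡ ∣ D /ℕ n ∣
        count h a<b refl = inversions-< h a<b

        i₀<j₀-case : i₀ Fin.< j₀ → ℓ g ℕ.+ ∣ x₀ - y₀ ∣ ≡ ℓ f ℕ.+ ∣ x₀ - y₀ - 1ℤ ∣
        i₀<j₀-case i₀<j₀ = subst₂ (λ u v → ℓ g ℕ.+ u ≡ ℓ f ℕ.+ v)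
          (trans (count f i₀<j₀ f-diff) (cong ∣_∣ (/ℕ-one+*N (x₀ - y₀))))
          (trans (count g i₀<j₀ g-diff) (cong ∣_∣ (/ℕ-minus-one+*N (x₀ - y₀))))
          (ℓ-update g f i₀ j₀ (off-pair i₀<j₀ (inj₁ (refl , refl))))
          where
          f-diff : f (rep j₀) - f (rep i₀) ≡ 1ℤ + (x₀ - y₀) * N
          f-diff = trans (cong₂ _-_ (f-rep-residue (c + 1ℤ)) (f-rep-residue c)) (l c x₀ y₀ N)
            where
            l : ∀ c x y N → c + 1ℤ + - y * N - (c + - x * N) ≡ 1ℤ + (x - y) * N
            l = solve-∀
          g-diff : g (rep j₀) - g (rep i₀) ≡ - 1ℤ + (x₀ - y₀) * N
          g-diff = trans (cong₂ _-_ g-j₀ g-i₀)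
            (trans (cong₂ (λ a b → a - 1ℤ - (b + 1ℤ)) (f-rep-residue (c + 1ℤ)) (f-rep-residue c)) (l c x₀ y₀ N))
            where
            l : ∀ c x y N → c + 1ℤ + - y * N - 1ℤ - (c + - x * N + 1ℤ) ≡ - 1ℤ + (x - y) * N
            l = solve-∀

        j₀<i₀-case : j₀ Fin.< i₀ → ℓ f ℕ.+ ∣ y₀ - x₀ ∣ ≡ ℓ g ℕ.+ ∣ y₀ - x₀ - 1ℤ ∣
        j₀<i₀-case j₀<i₀ = subst₂ (λ u v → ℓ f ℕ.+ u ≡ ℓ g ℕ.+ v)
          (trans (count g j₀<i₀ g-diff) (cong ∣_∣ (/ℕ-one+*N (y₀ - x₀))))
          (trans (count f j₀<i₀ f-diff) (cong ∣_∣ (/ℕ-minus-one+*N (y₀ - x₀))))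
          (sym (ℓ-update g f j₀ i₀ (off-pair j₀<i₀ (inj₂ (refl , refl)))))
          where
          f-diff : f (rep i₀) - f (rep j₀) ≡ - 1ℤ + (y₀ - x₀) * N
          f-diff = trans (cong₂ _-_ (f-rep-residue c) (f-rep-residue (c + 1ℤ))) (l c x₀ y₀ N)
            where
            l : ∀ c x y N → c + - x * N - (c + 1ℤ + - y * N) ≡ - 1ℤ + (y - x) * N
            l = solve-∀
          g-diff : g (rep i₀) - g (rep j₀) ≡ 1ℤ + (y₀ - x₀) * N
          g-diff = trans (cong₂ _-_ g-i₀ g-j₀)
            (trans (cong₂ (λ a b → a + 1ℤ - (b - 1ℤ)) (f-rep-residue c) (f-rep-residue (c + 1ℤ))) (l c x₀ y₀ N))
            where
            l : ∀ c x y N → c + - x * N + 1ℤ - (c + 1ℤ + - y * N - 1ℤ) ≡ 1ℤ + (y - x) * N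
            l = solve-∀

        inv-c≡ : inv c ≡ rep i₀ + x₀ * N
        inv-c≡ = rep-residue-block (inv c)
        inv-c+1≡ : inv (c + 1ℤ) ≡ rep j₀ + y₀ * N
        inv-c+1≡ = rep-residue-block (inv (c + 1ℤ))

      descent : inv (c + 1ℤ) < inv c → suc (ℓ (s c ∘ f)) ≡ ℓ f
      descent desc with Finₚ.<-cmp i₀ j₀
      ... | tri< i₀<j₀ _ _ = proj₁ (cancel-∣i∣-∣i-1∣ (i₀<j₀-case i₀<j₀))
                                  (proj₁ (rep-order i₀<j₀ x₀ y₀) (subst₂ _<_ inv-c+1≡ inv-c≡ desc))
      ... | tri≈ _ i₀≡j₀ _ = ⊥-elim (i₀≢j₀ i₀≡j₀)
      ... | tri> _ _ j₀<i₀ = sym (proj₂ (cancel-∣i∣-∣i-1∣ (j₀<i₀-case j₀<i₀))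
                                  (proj₂ (rep-order j₀<i₀ y₀ x₀) (subst₂ _<_ inv-c+1≡ inv-c≡ desc)))

      ascent : inv c < inv (c + 1ℤ) → ℓ (s c ∘ f) ≡ suc (ℓ f)
      ascent asc with Finₚ.<-cmp i₀ j₀
      ... | tri< i₀<j₀ _ _ = proj₂ (cancel-∣i∣-∣i-1∣ (i₀<j₀-case i₀<j₀))
                                  (proj₂ (rep-order i₀<j₀ x₀ y₀) (subst₂ _<_ inv-c≡ inv-c+1≡ asc))
      ... | tri≈ _ i₀≡j₀ _ = ⊥-elim (i₀≢j₀ i₀≡j₀)
      ... | tri> _ _ j₀<i₀ = sym (proj₁ (cancel-∣i∣-∣i-1∣ (j₀<i₀-case j₀<i₀))
                                  (proj₁ (rep-order j₀<i₀ y₀ x₀) (subst₂ _<_ inv-c≡ inv-c+1≡ asc)))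

      inv-c≢inv-c+1 : inv c ≢ inv (c + 1ℤ)
      inv-c≢inv-c+1 eq = x+1≢ₙx c (≡ₙ-reflexive (trans (sym (f-inv (c + 1ℤ))) (trans (cong f (sym eq)) (f-inv c))))

      ≤+1 : ℓ (s c ∘ f) ℕ.≤ suc (ℓ f)
      ≤+1 with ℤₚ.<-cmp (inv c) (inv (c + 1ℤ))
      ... | tri< asc _ _  = ℕₚ.≤-reflexive (ascent asc)
      ... | tri≈ _ eq _   = ⊥-elim (inv-c≢inv-c+1 eq)
      ... | tri> _ _ desc = ℕₚ.≤-trans (ℕₚ.n≤1+n _) (ℕₚ.≤-trans (ℕₚ.≤-reflexive (descent desc)) (ℕₚ.n≤1+n _))

    balanced-s∘ : ∀ {f} → IsPeriodicBijection f → ∀ c → Balanced f → Balanced (s c ∘ f)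
    balanced-s∘ {f} F c balanced = trans sum-unchanged balanced
      where
      open Exchange F c
      raised : Fin n → ℤ
      raised t with t Fin.≟ i₀
      ... | yes _ = f (rep t) + 1ℤ
      ... | no  _ = f (rep t)
      raised-i₀ : raised i₀ ≡ f (rep i₀) + 1ℤ
      raised-i₀ with i₀ Fin.≟ i₀
      ... | yes _   = refl
      ... | no i₀≢i₀ = ⊥-elim (i₀≢i₀ refl)
      raised-j₀ : raised j₀ ≡ f (rep j₀)
      raised-j₀ with j₀ Fin.≟ i₀
      ... | yes j₀≡i₀ = ⊥-elim (i₀≢j₀ (sym j₀≡i₀))
      ... | no  _     = refl
      s∘f≈raised : ∀ t → t ≢ j₀ → s c (f (rep t)) ≡ raised t
      s∘f≈raised t t≢j₀ with t Fin.≟ i₀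
      ... | yes refl  = s-at-c f-i₀
      ... | no  t≢i₀  = s-elsewhere (t≢i₀ ∘ only-i₀) (t≢j₀ ∘ only-j₀)
      raised≈f : ∀ t → t ≢ i₀ → raised t ≡ f (rep t)
      raised≈f t t≢i₀ with t Fin.≟ i₀
      ... | yes t≡i₀ = ⊥-elim (t≢i₀ t≡i₀)
      ... | no  _    = refl
      sum-unchanged : sumℤ (s c ∘ f ∘ rep) ≡ sumℤ (f ∘ rep)
      sum-unchanged = begin
        sumℤ (s c ∘ f ∘ rep)
          ≡⟨ sumℤ-update (s c ∘ f ∘ rep) raised j₀ s∘f≈raised ⟩
        sumℤ raised + (s c (f (rep j₀)) - raised j₀)
          ≡⟨ cong₂ (λ u v → u + (v - raised j₀)) (sumℤ-update raised (f ∘ rep) i₀ raised≈f) (s-at-c+1 f-j₀) ⟩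
        sumℤ (f ∘ rep) + (raised i₀ - f (rep i₀)) + (f (rep j₀) - 1ℤ - raised j₀)
          ≡⟨ cong₂ (λ u v → sumℤ (f ∘ rep) + (u - f (rep i₀)) + (f (rep j₀) - 1ℤ - v)) raised-i₀ raised-j₀ ⟩
        sumℤ (f ∘ rep) + (f (rep i₀) + 1ℤ - f (rep i₀)) + (f (rep j₀) - 1ℤ - f (rep j₀))
          ≡⟨ l (sumℤ (f ∘ rep)) (f (rep i₀)) (f (rep j₀)) ⟩
        sumℤ (f ∘ rep) ∎
        where
        open ≡-Reasoning
        l : ∀ S x y → S + (x + 1ℤ - x) + (y - 1ℤ - y) ≡ S
        l = solve-∀

    eval-isPB : ∀ l → IsPeriodicBijection (eval n l)
    eval-isPB []      = id-isPB
    eval-isPB (k ∷ l) = ≗-isPB (λ x → sym (gen≡s k (eval n l x))) (∘-isPB (s-isPB (rep k)) (eval-isPB l))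

    ℓ-eval-∷ : ∀ k l → ℓ (eval n (k ∷ l)) ≡ ℓ (s (rep k) ∘ eval n l)
    ℓ-eval-∷ k l = ℓ-cong (λ x → gen≡s k (eval n l x))

    ℓ-eval≤length : ∀ l → ℓ (eval n l) ℕ.≤ length l
    ℓ-eval≤length []      = ℕₚ.≤-reflexive ℓ-id
    ℓ-eval≤length (k ∷ l) = begin
      ℓ (eval n (k ∷ l))          ≡⟨ ℓ-eval-∷ k l ⟩
      ℓ (s (rep k) ∘ eval n l)    ≤⟨ Exchange.≤+1 (eval-isPB l) (rep k) ⟩
      suc (ℓ (eval n l))          ≤⟨ ℕ.s≤s (ℓ-eval≤length l) ⟩
      length (k ∷ l)              ∎
      where open ℕₚ.≤-Reasoning

    gen-residue : ∀ c x → gen n (residue n c) x ≡ s c x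
    gen-residue c x = trans (gen≡s (residue n c) x) (s-cong x (≡ₙ-sym (≡ₙ-rep-residue c)))

    module _ {f} (F : IsPeriodicBijection f) where
      open IsPeriodicBijection F

      Increasing : Set
      Increasing = ∀ x → inv x < inv (x + 1ℤ)

      descent-or-increasing : (∃[ c ] inv (c + 1ℤ) < inv c) ⊎ Increasing
      descent-or-increasing with Finₚ.all? (λ k → inv (rep k) ℤₚ.<? inv (rep k + 1ℤ))
      ... | yes window-increasing = inj₂ increasing
        where
        increasing : Increasing
        increasing x = subst₂ _<_ (sym inv-x) (sym inv-x+1) (ℤₚ.+-monoˡ-< (block x * N) (window-increasing k))
          where
          k : Fin n
          k = residue n x
          l : ∀ r q N → r + q * N + 1ℤ ≡ r + 1ℤ + q * N
          l = solve-∀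
          inv-x : inv x ≡ inv (rep k) + block x * N
          inv-x = trans (cong inv (rep-residue-block x)) (inv-periodic-* (rep k) (block x))
          inv-x+1 : inv (x + 1ℤ) ≡ inv (rep k + 1ℤ) + block x * N
          inv-x+1 = trans (cong inv (trans (cong (_+ 1ℤ) (rep-residue-block x)) (l (rep k) (block x) N)))
                          (inv-periodic-* (rep k + 1ℤ) (block x))
      ... | no ¬window-increasing with Finₚ.¬∀⟶∃¬ n _ (λ k → inv (rep k) ℤₚ.<? inv (rep k + 1ℤ)) ¬window-increasing
      ...   | k , ¬inc = inj₁ (rep k , ℤₚ.≤∧≢⇒< (ℤₚ.≮⇒≥ ¬inc) λ eq → x+1≢ₙx (rep k) (≡ₙ-reflexive (injective-inv eq)))
        where
        injective-inv : ∀ {x y} → inv x ≡ inv y → x ≡ y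
        injective-inv {x} {y} eq = trans (sym (f-inv x)) (trans (cong f eq) (f-inv y))

      increasing⇒+≤ : Increasing → ∀ x m → inv x + + m ≤ inv (x + + m)
      increasing⇒+≤ increasing x zero    = ℤₚ.≤-reflexive (trans (ℤₚ.+-identityʳ (inv x)) (cong inv (sym (ℤₚ.+-identityʳ x))))
      increasing⇒+≤ increasing x (suc m) = begin
        inv x + + suc m          ≡⟨ l (inv x) (+ m) ⟩
        1ℤ + (inv x + + m)       ≤⟨ ℤₚ.+-monoʳ-≤ 1ℤ (increasing⇒+≤ increasing x m) ⟩
        1ℤ + inv (x + + m)       ≤⟨ ℤₚ.i<j⇒suc[i]≤j (increasing (x + + m)) ⟩
        inv (x + + m + 1ℤ)       ≡⟨ cong inv (trans (ℤₚ.+-assoc x (+ m) 1ℤ) (cong (λ t → x + t) (ℤₚ.+-comm (+ m) 1ℤ))) ⟩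
        inv (x + + suc m)        ∎
        where
        open ℤₚ.≤-Reasoning
        l : ∀ a m → a + (1ℤ + m) ≡ 1ℤ + (a + m)
        l = solve-∀

      increasing⇒unit-steps : Increasing → ∀ x → inv (x + 1ℤ) ≡ inv x + 1ℤ
      increasing⇒unit-steps increasing x = ℤₚ.≤-antisym upper lower
        where
        m : ℕ
        m = ℕ.pred n
        N≡1+m : N ≡ 1ℤ + + m
        N≡1+m = cong +_ (sym (ℕₚ.suc-pred n))
        lower : inv x + 1ℤ ≤ inv (x + 1ℤ)
        lower = subst (_≤ inv (x + 1ℤ)) (ℤₚ.+-comm 1ℤ (inv x)) (ℤₚ.i<j⇒suc[i]≤j (increasing x))
        inv-x+N : inv (x + 1ℤ + + m) ≡ inv x + 1ℤ + + m
        inv-x+N = begin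
          inv (x + 1ℤ + + m)   ≡⟨ cong inv (trans (ℤₚ.+-assoc x 1ℤ (+ m)) (cong (λ t → x + t) (sym N≡1+m))) ⟩
          inv (x + N)          ≡⟨ cong (λ t → inv (x + t)) (sym (ℤₚ.*-identityˡ N)) ⟩
          inv (x + 1ℤ * N)     ≡⟨ inv-periodic-* x 1ℤ ⟩
          inv x + 1ℤ * N       ≡⟨ cong (λ t → inv x + t) (trans (ℤₚ.*-identityˡ N) N≡1+m) ⟩
          inv x + (1ℤ + + m)   ≡⟨ ℤₚ.+-assoc (inv x) 1ℤ (+ m) ⟨
          inv x + 1ℤ + + m     ∎
          where open ≡-Reasoning
        upper : inv (x + 1ℤ) ≤ inv x + 1ℤ
        upper = ≤-by-diff (subst (inv (x + 1ℤ) + + m ≤_) inv-x+N (increasing⇒+≤ increasing (x + 1ℤ) m))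
                          (l (inv x) (inv (x + 1ℤ)) (+ m))
          where
          l : ∀ a b m → a + 1ℤ - b ≡ a + 1ℤ + m - (b + m)
          l = solve-∀

      increasing⇒id : Increasing → Balanced f → ∀ y → f y ≡ y
      increasing⇒id increasing balanced y = trans (translation y) (trans (cong (λ t → y + t) K≡0) (ℤₚ.+-identityʳ y))
        where
        f-unit-steps : ∀ y → f (y + 1ℤ) ≡ f y + 1ℤ
        f-unit-steps y = begin
          f (y + 1ℤ)             ≡⟨ cong (λ t → f (t + 1ℤ)) (inv-f y) ⟨
          f (inv (f y) + 1ℤ)     ≡⟨ cong f (increasing⇒unit-steps increasing (f y)) ⟨
          f (inv (f y + 1ℤ))     ≡⟨ f-inv (f y + 1ℤ) ⟩
          f y + 1ℤ               ∎
          where open ≡-Reasoning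
        K : ℤ
        K = f 0ℤ
        translation : ∀ y → f y ≡ y + K
        translation = +1-equivariant⇒translation f f-unit-steps
        nK≡0 : + n * K ≡ + n * 0ℤ
        nK≡0 = begin
          + n * K                                   ≡⟨ l (sumℤ rep) (+ n * K) ⟩
          sumℤ rep + + n * K - sumℤ rep             ≡⟨ cong (λ v → sumℤ rep + v - sumℤ rep) (sumℤ-const {n} K) ⟨
          sumℤ rep + sumℤ {n} (λ _ → K) - sumℤ rep  ≡⟨ cong (_- sumℤ rep) (sumℤ-+ rep (λ _ → K)) ⟨
          sumℤ (λ t → rep t + K) - sumℤ rep         ≡⟨ cong (_- sumℤ rep) (sumℤ-cong (λ t → translation (rep t))) ⟨
          sumℤ (f ∘ rep) - sumℤ rep                 ≡⟨ cong (_- sumℤ rep) balanced ⟩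
          sumℤ rep - sumℤ rep                       ≡⟨ ℤₚ.+-inverseʳ (sumℤ rep) ⟩
          0ℤ                                        ≡⟨ ℤₚ.*-zeroʳ (+ n) ⟨
          + n * 0ℤ                                  ∎
          where
          open ≡-Reasoning
          l : ∀ S x → x ≡ S + x - S
          l = solve-∀
        K≡0 : K ≡ 0ℤ
        K≡0 = ℤₚ.*-cancelˡ-≡ (+ n) K 0ℤ nK≡0

    record ReducedWord (f : ℤ → ℤ) : Set where
      constructor reducedWord
      field
        word      : Word n
        evaluates : ∀ x → eval n word x ≡ f x
        length≡ℓ  : length word ≡ ℓ f

    prepend-descent : ∀ {f} c → suc (ℓ (s c ∘ f)) ≡ ℓ f → ReducedWord (s c ∘ f) → ReducedWord f
    prepend-descent {f} c shorter (reducedWord l evaluates length≡ℓ) = reducedWord (residue n c ∷ l)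
      (λ x → trans (gen-residue c (eval n l x)) (trans (cong (s c) (evaluates x)) (s-involutive c (f x))))
      (trans (cong suc length≡ℓ) shorter)

    reduced-word-of-length : ∀ k {f} → IsPeriodicBijection f → Balanced f → ℓ f ≡ k → ReducedWord f
    reduced-word-of-length k {f} F balanced ℓf≡k with descent-or-increasing F
    ... | inj₂ increasing = reducedWord [] (λ x → sym (is-id x)) (sym (trans (ℓ-cong is-id) ℓ-id))
      where
      is-id : ∀ x → f x ≡ x
      is-id = increasing⇒id F increasing balanced
    ... | inj₁ (c , desc) = prepend-descent c shorter (shorten k ℓf≡k)
      where
      shorter : suc (ℓ (s c ∘ f)) ≡ ℓ f
      shorter = Exchange.descent F c desc
      shorten : ∀ k → ℓ f ≡ k → ReducedWord (s c ∘ f)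
      shorten zero    ℓf≡0   = ⊥-elim (ℕₚ.1+n≢0 (trans shorter ℓf≡0))
      shorten (suc k) ℓf≡1+k = reduced-word-of-length k (∘-isPB (s-isPB c) F) (balanced-s∘ F c balanced)
                                 (ℕₚ.suc-injective (trans shorter ℓf≡1+k))

    reduced-word : ∀ {f} → IsPeriodicBijection f → Balanced f → ReducedWord f
    reduced-word {f} F balanced = reduced-word-of-length (ℓ f) F balanced refl

    ascent-of-lengthening : ∀ {g} (G : IsPeriodicBijection g) c → ℓ (s c ∘ g) ≡ suc (ℓ g) →
                            PB.inv G c < PB.inv G (c + 1ℤ)
    ascent-of-lengthening {g} G c longer with ℤₚ.<-cmp (PB.inv G c) (PB.inv G (c + 1ℤ))
    ... | tri< asc _ _  = asc
    ... | tri≈ _ eq _   = ⊥-elim (Exchange.inv-c≢inv-c+1 G c eq)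
    ... | tri> _ _ desc = ⊥-elim (ℕₚ.<⇒≢ (ℕₚ.<-trans (ℕₚ.n<1+n _) (ℕₚ.n<1+n _))
                                         (sym (trans (cong suc (sym longer)) (Exchange.descent G c desc))))

    s-preserves-inversion : ∀ {g} (G : IsPeriodicBijection g) c → PB.inv G c < PB.inv G (c + 1ℤ) →
                            ∀ {a b} → a < b → g b < g a → s c (g b) < s c (g a)
    s-preserves-inversion {g} G c asc {a} {b} a<b gb<ga = s-mono-< c gb<ga exception
      where
      open IsPeriodicBijection G
      exception : ¬ (g b ≡ₙ c × g a ≡ g b + 1ℤ)
      exception ((q , gb≡c+qN) , ga≡gb+1) = ℤₚ.<-asym asc (<-by-diff (subst₂ _<_ a≡ b≡ a<b) (l (inv c) (inv (c + 1ℤ)) q N))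
        where
        l : ∀ x y q N → x - y ≡ x + q * N - (y + q * N)
        l = solve-∀
        l′ : ∀ c q N → c + q * N + 1ℤ ≡ c + 1ℤ + q * N
        l′ = solve-∀
        b≡ : b ≡ inv c + q * N
        b≡ = trans (sym (inv-f b)) (trans (cong inv gb≡c+qN) (inv-periodic-* c q))
        a≡ : a ≡ inv (c + 1ℤ) + q * N
        a≡ = trans (sym (inv-f a)) (trans (cong inv (trans ga≡gb+1 (trans (cong (_+ 1ℤ) gb≡c+qN) (l′ c q N))))
                                          (inv-periodic-* (c + 1ℤ) q))

    ascent-periodic : ∀ {g} (G : IsPeriodicBijection g) {x x'} → x ≡ₙ x' →
                      PB.inv G x < PB.inv G (x + 1ℤ) → PB.inv G x' < PB.inv G (x' + 1ℤ)
    ascent-periodic G {x' = x'} (q , refl) asc =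
      <-by-diff (subst₂ _<_ (inv-periodic-* x' q) inv-x'+1 asc) (l (inv x') (inv (x' + 1ℤ)) q N)
      where
      open IsPeriodicBijection G
      l : ∀ u v q N → v - u ≡ v + q * N - (u + q * N)
      l = solve-∀
      l′ : ∀ x q N → x + q * N + 1ℤ ≡ x + 1ℤ + q * N
      l′ = solve-∀
      inv-x'+1 : inv (x' + q * N + 1ℤ) ≡ inv (x' + 1ℤ) + q * N
      inv-x'+1 = trans (cong inv (l′ x' q N)) (inv-periodic-* (x' + 1ℤ) q)

    IsReducedWord : Word n → Set
    IsReducedWord l = ℓ (eval n l) ≡ length l

    reduced-tail : ∀ k l → IsReducedWord (k ∷ l) →
                   IsReducedWord l × ℓ (s (rep k) ∘ eval n l) ≡ suc (ℓ (eval n l))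
    reduced-tail k l reduced = tail-reduced , trans ℓ-s∘≡ (cong suc (sym tail-reduced))
      where
      ℓ-s∘≡ : ℓ (s (rep k) ∘ eval n l) ≡ suc (length l)
      ℓ-s∘≡ = trans (sym (ℓ-eval-∷ k l)) reduced
      tail-reduced : IsReducedWord l
      tail-reduced = ℕₚ.≤-antisym (ℓ-eval≤length l)
        (ℕₚ.≤-pred (subst (ℕ._≤ suc (ℓ (eval n l))) ℓ-s∘≡ (Exchange.≤+1 (eval-isPB l) (rep k))))

    reduced-suffix : ∀ pre m → IsReducedWord (pre ++ m) → IsReducedWord m
    reduced-suffix []        m reduced = reduced
    reduced-suffix (k ∷ pre) m reduced = reduced-suffix pre m (proj₁ (reduced-tail k (pre ++ m) reduced))

    reduced-head-ascent : ∀ k l → IsReducedWord (k ∷ l) →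
                          PB.inv (eval-isPB l) (rep k) < PB.inv (eval-isPB l) (rep k + 1ℤ)
    reduced-head-ascent k l reduced = ascent-of-lengthening (eval-isPB l) (rep k) (proj₂ (reduced-tail k l reduced))

    reduced-prefix-preserves-inversion : ∀ pre m → IsReducedWord (pre ++ m) → ∀ {a b} → a < b →
                                         eval n m b < eval n m a → eval n (pre ++ m) b < eval n (pre ++ m) a
    reduced-prefix-preserves-inversion []        m reduced a<b inverted = inverted
    reduced-prefix-preserves-inversion (k ∷ pre) m reduced a<b inverted =
      subst₂ _<_ (sym (gen≡s k _)) (sym (gen≡s k _))
        (s-preserves-inversion (eval-isPB (pre ++ m)) (rep k) (reduced-head-ascent k (pre ++ m) reduced) a<b
          (reduced-prefix-preserves-inversion pre m (proj₁ (reduced-tail k (pre ++ m) reduced)) a<b inverted))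

    s[c+1]-c : ∀ c → s (c + 1ℤ) c ≡ c
    s[c+1]-c c = subst (λ x → s (c + 1ℤ) x ≡ x) (i+1-1≡i c) (s-c-1 (c + 1ℤ))

    braid-reverses : ∀ t → let X = s t ∘ s (t + 1ℤ) ∘ s t in
                     X t ≡ t + 1ℤ + 1ℤ × X (t + 1ℤ) ≡ t + 1ℤ × X (t + 1ℤ + 1ℤ) ≡ t
    braid-reverses t =
        trans (cong (s t ∘ s (t + 1ℤ)) (s-c t)) (trans (cong (s t) (s-c (t + 1ℤ))) (s-c+2 t))
      , trans (cong (s t ∘ s (t + 1ℤ)) (s-c+1 t)) (trans (cong (s t) (s[c+1]-c t)) (s-c t))
      , trans (cong (s t ∘ s (t + 1ℤ)) (s-c+2 t)) (trans (cong (s t) (s-c+1 (t + 1ℤ))) (s-c+1 t))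

    braid-reverses′ : ∀ t → let X = s (t + 1ℤ) ∘ s t ∘ s (t + 1ℤ) in
                      X t ≡ t + 1ℤ + 1ℤ × X (t + 1ℤ) ≡ t + 1ℤ × X (t + 1ℤ + 1ℤ) ≡ t
    braid-reverses′ t =
        trans (cong (s (t + 1ℤ) ∘ s t) (s[c+1]-c t)) (trans (cong (s (t + 1ℤ)) (s-c t)) (s-c (t + 1ℤ)))
      , trans (cong (s (t + 1ℤ) ∘ s t) (s-c (t + 1ℤ))) (trans (cong (s (t + 1ℤ)) (s-c+2 t)) (s-c+1 (t + 1ℤ)))
      , trans (cong (s (t + 1ℤ) ∘ s t) (s-c+1 (t + 1ℤ))) (trans (cong (s (t + 1ℤ)) (s-c+1 t)) (s[c+1]-c t))

    reversal⇒321 : ∀ {v} (V : IsPeriodicBijection v) (X : ℤ → ℤ) t →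
                   X t ≡ t + 1ℤ + 1ℤ × X (t + 1ℤ) ≡ t + 1ℤ × X (t + 1ℤ + 1ℤ) ≡ t →
                   PB.inv V t < PB.inv V (t + 1ℤ) → PB.inv V (t + 1ℤ) < PB.inv V (t + 1ℤ + 1ℤ) →
                   Has321 (X ∘ v)
    reversal⇒321 {v} V X t (X₀ , X₁ , X₂) p₀<p₁ p₁<p₂ =
      PB.inv V t , PB.inv V (t + 1ℤ) , PB.inv V (t + 1ℤ + 1ℤ) , p₀<p₁ , p₁<p₂ ,
      subst₂ _<_ (X-at (t + 1ℤ) X₁) (X-at t X₀) (i<i+1 (t + 1ℤ)) ,
      subst₂ _<_ (X-at (t + 1ℤ + 1ℤ) X₂) (X-at (t + 1ℤ) X₁) (i<i+1 t)
      where
      X-at : ∀ y {z} → X y ≡ z → z ≡ X (v (PB.inv V y))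
      X-at y Xy≡z = trans (sym Xy≡z) (cong X (sym (PB.f-inv V y)))

    -- The three ascents order the positions of c, c + 1, c + 2 (or c - 1, c, c + 1), which the
    -- braid reverses; b ≡ c or b far from c would make the word non-reduced.
    braid⇒321 : ∀ i j suf → IsReducedWord (i ∷ j ∷ i ∷ suf) → Has321 (eval n (i ∷ j ∷ i ∷ suf))
    braid⇒321 i j suf reduced₃ = by-position (b ≡ₙ? c) (b ≡ₙ? (c + 1ℤ)) (b ≡ₙ? (c - 1ℤ))
      where
      c b : ℤ
      c = rep i
      b = rep j
      σ w : ℤ → ℤ
      σ = eval n suf
      w = eval n (i ∷ j ∷ i ∷ suf)
      S : IsPeriodicBijection σ
      S = eval-isPB suf
      σ⁻¹ : ℤ → ℤ
      σ⁻¹ = PB.inv S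
      reduced₂ : IsReducedWord (j ∷ i ∷ suf)
      reduced₂ = proj₁ (reduced-tail i (j ∷ i ∷ suf) reduced₃)
      reduced₁ : IsReducedWord (i ∷ suf)
      reduced₁ = proj₁ (reduced-tail j (i ∷ suf) reduced₂)
      asc₁ : σ⁻¹ c < σ⁻¹ (c + 1ℤ)
      asc₁ = reduced-head-ascent i suf reduced₁
      asc₂ : ∀ {b'} → b ≡ₙ b' → σ⁻¹ (s c b') < σ⁻¹ (s c (b' + 1ℤ))
      asc₂ b≡b' = ascent-periodic (eval-isPB (i ∷ suf)) b≡b' (reduced-head-ascent j (i ∷ suf) reduced₂)
      asc₃ : ∀ {b'} → b ≡ₙ b' → σ⁻¹ (s c (s b' c)) < σ⁻¹ (s c (s b' (c + 1ℤ)))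
      asc₃ b≡b' = subst₂ (λ x y → σ⁻¹ (s c x) < σ⁻¹ (s c y)) (s-cong c b≡b') (s-cong (c + 1ℤ) b≡b')
                         (reduced-head-ascent i (j ∷ i ∷ suf) reduced₃)
      w≗ : ∀ {b'} → b ≡ₙ b' → ∀ x → s c (s b' (s c (σ x))) ≡ w x
      w≗ {b'} b≡b' x = sym (trans (gen≡s i _)
        (cong (s c) (trans (gen≡s j _) (trans (s-cong _ b≡b') (cong (s b') (gen≡s i _))))))
      by-position : Dec (b ≡ₙ c) → Dec (b ≡ₙ c + 1ℤ) → Dec (b ≡ₙ c - 1ℤ) → Has321 w
      by-position (yes b≡c) _ _ =
        ⊥-elim (ℤₚ.<-asym asc₁ (subst₂ (λ x y → σ⁻¹ x < σ⁻¹ y) (s-c c) (s-c+1 c) (asc₂ b≡c)))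
      by-position (no _) (yes b≡c+1) _ =
        Has321-≗ (w≗ b≡c+1) (reversal⇒321 S (s c ∘ s (c + 1ℤ) ∘ s c) c (braid-reverses c) asc₁
          (subst₂ (λ x y → σ⁻¹ x < σ⁻¹ y)
            (trans (cong (s c) (s[c+1]-c c)) (s-c c))
            (trans (cong (s c) (s-c (c + 1ℤ))) (s-c+2 c))
            (asc₃ b≡c+1)))
      by-position (no _) (no _) (yes b≡d) =
        Has321-≗ (subst (λ c′ → ∀ x → s c′ (s d (s c′ (σ x))) ≡ w x) c≡d+1 (w≗ b≡d))
          (reversal⇒321 S (s (d + 1ℤ) ∘ s d ∘ s (d + 1ℤ)) d (braid-reverses′ d)
            (subst₂ (λ x y → σ⁻¹ x < σ⁻¹ y)
              (trans (cong (s (d + 1ℤ)) (s-c+1 d)) (s[c+1]-c d))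
              (trans (cong (s (d + 1ℤ)) (s-c+2 d)) (s-c+1 (d + 1ℤ)))
              (subst (λ c′ → σ⁻¹ (s c′ (s d c′)) < σ⁻¹ (s c′ (s d (c′ + 1ℤ)))) c≡d+1 (asc₃ b≡d)))
            (subst (λ c′ → σ⁻¹ c′ < σ⁻¹ (c′ + 1ℤ)) c≡d+1 asc₁))
        where
        d : ℤ
        d = c - 1ℤ
        c≡d+1 : c ≡ d + 1ℤ
        c≡d+1 = sym (i-1+1≡i c)
      by-position (no b≢c) (no b≢c+1) (no b≢c-1) =
        ⊥-elim (ℤₚ.<-asym asc₁ (subst₂ (λ x y → σ⁻¹ x < σ⁻¹ y)
          (trans (cong (s c) s-b-c) (s-c c)) (trans (cong (s c) s-b-c+1) (s-c+1 c)) (asc₃ ≡ₙ-refl)))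
        where
        s-b-c : s b c ≡ c
        s-b-c = s-elsewhere (b≢c ∘ ≡ₙ-sym)
          (λ c≡b+1 → b≢c-1 (≡ₙ-sym (subst (c - 1ℤ ≡ₙ_) (i+1-1≡i b) (≡ₙ-+ʳ (- 1ℤ) c≡b+1))))
        s-b-c+1 : s b (c + 1ℤ) ≡ c + 1ℤ
        s-b-c+1 = s-elsewhere (b≢c+1 ∘ ≡ₙ-sym) (b≢c ∘ ≡ₙ-sym ∘ ≡ₙ-+ʳ⁻¹ 1ℤ)

    BraidedReducedWord : (ℤ → ℤ) → Set
    BraidedReducedWord f = Σ (ReducedWord f) (ContainsBraid n ∘ ReducedWord.word)

    prepend-descent-braided : ∀ {f} c → suc (ℓ (s c ∘ f)) ≡ ℓ f →
                              BraidedReducedWord (s c ∘ f) → BraidedReducedWord f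
    prepend-descent-braided c shorter (r , pre , suf , i , j , word≡) =
      prepend-descent c shorter r , residue n c ∷ pre , suf , i , j , cong (residue n c ∷_) word≡

    module _ {f} (F : IsPeriodicBijection f) (balanced : Balanced f)
             (after-descent : ∀ c → PB.inv F (c + 1ℤ) < PB.inv F c → Has321 (s c ∘ f) → BraidedReducedWord (s c ∘ f))
             where
      open IsPeriodicBijection F

      private
        descent-keeping-321 : ∀ c {a b d} → a < b → b < d → inv (c + 1ℤ) < inv c →
                              ¬ (f b ≡ₙ c × f a ≡ f b + 1ℤ) → ¬ (f d ≡ₙ c × f b ≡ f d + 1ℤ) →
                              f b < f a → f d < f b → BraidedReducedWord f
        descent-keeping-321 c {a} {b} {d} a<b b<d desc exception₁ exception₂ fb<fa fd<fb =
          prepend-descent-braided c (Exchange.descent F c desc)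
            (after-descent c desc (a , b , d , a<b , b<d , s-mono-< c fb<fa exception₁ , s-mono-< c fd<fb exception₂))

        consecutive-braid : ∀ a b d → a < b → b < d → f a ≡ f d + 1ℤ + 1ℤ → f b ≡ f d + 1ℤ → BraidedReducedWord f
        consecutive-braid a b d a<b b<d fa≡ fb≡ =
          prepend-descent C (Exchange.descent F C desc₁)
            (prepend-descent (C + 1ℤ) (Exchange.descent F₁ (C + 1ℤ) desc₂)
              (prepend-descent C (Exchange.descent F₂ C desc₃) r₃))
          , [] , ReducedWord.word r₃ , residue n C , residue n (C + 1ℤ) , refl
          where
          C : ℤ
          C = f d
          F₁ : IsPeriodicBijection (s C ∘ f)
          F₁ = ∘-isPB (s-isPB C) F
          F₂ : IsPeriodicBijection (s (C + 1ℤ) ∘ s C ∘ f)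
          F₂ = ∘-isPB (s-isPB (C + 1ℤ)) F₁
          F₃ : IsPeriodicBijection (s C ∘ s (C + 1ℤ) ∘ s C ∘ f)
          F₃ = ∘-isPB (s-isPB C) F₂
          r₃ : ReducedWord (s C ∘ s (C + 1ℤ) ∘ s C ∘ f)
          r₃ = reduced-word F₃ (balanced-s∘ F₂ C (balanced-s∘ F₁ (C + 1ℤ) (balanced-s∘ F C balanced)))
          inv-C : inv C ≡ d
          inv-C = inv-f d
          inv-C+1 : inv (C + 1ℤ) ≡ b
          inv-C+1 = trans (cong inv (sym fb≡)) (inv-f b)
          inv-C+2 : inv (C + 1ℤ + 1ℤ) ≡ a
          inv-C+2 = trans (cong inv (sym fa≡)) (inv-f a)
          desc₁ : inv (C + 1ℤ) < inv C
          desc₁ = subst₂ _<_ (sym inv-C+1) (sym inv-C) b<d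
          desc₂ : inv (s C (C + 1ℤ + 1ℤ)) < inv (s C (C + 1ℤ))
          desc₂ = subst₂ _<_ (sym (trans (cong inv (s-c+2 C)) inv-C+2)) (sym (trans (cong inv (s-c+1 C)) inv-C))
                             (ℤₚ.<-trans a<b b<d)
          desc₃ : inv (s C (s (C + 1ℤ) (C + 1ℤ))) < inv (s C (s (C + 1ℤ) C))
          desc₃ = subst₂ _<_ (sym (trans (cong (inv ∘ s C) (s-c (C + 1ℤ))) (trans (cong inv (s-c+2 C)) inv-C+2)))
                             (sym (trans (cong (inv ∘ s C) (s[c+1]-c C)) (trans (cong inv (s-c C)) inv-C+1)))
                             a<b

      -- Either f a - 1 (resp. f d + 1) is taken at a position that replaces a (resp. d) with a
      -- smaller value range, or it is a descent keeping the pattern, or the values are consecutive.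
      321⇒braided-by-gap : ∀ gap a b d → a < b → b < d → f b < f a → f d < f b → f a - f d ≤ + gap →
                           BraidedReducedWord f
      321⇒braided-by-gap zero a b d a<b b<d fb<fa fd<fb gap =
        ⊥-elim (ℤₚ.<⇒≱ (<⇒0<- (ℤₚ.<-trans fd<fb fb<fa)) gap)
      321⇒braided-by-gap (suc gap) a b d a<b b<d fb<fa fd<fb gap-bound
        with f a - 1ℤ ℤₚ.≟ f b | f b - 1ℤ ℤₚ.≟ f d
      ... | no fa-1≢fb | _ = lower-top (ℤₚ.<-cmp t a)
        where
        t : ℤ
        t = inv (f a - 1ℤ)
        ft≡ : f t ≡ f a - 1ℤ
        ft≡ = f-inv (f a - 1ℤ)
        fa≢fb+1 : f a ≢ f b + 1ℤ
        fa≢fb+1 fa≡fb+1 = fa-1≢fb (trans (cong (_- 1ℤ) fa≡fb+1) (i+1-1≡i (f b)))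
        lower-top : Tri (t < a) (t ≡ a) (a < t) → BraidedReducedWord f
        lower-top (tri< t<a _ _) = 321⇒braided-by-gap gap t b d (ℤₚ.<-trans t<a a<b) b<d
          (subst (f b <_) (sym ft≡) (<∧≢⇒<-1 fb<fa fa≢fb+1)) fd<fb
          (subst (λ x → x - f d ≤ + gap) (sym ft≡) (≤-by-diff gap-bound (l (f a) (f d) (+ gap))))
          where
          l : ∀ A D G → G - (A - 1ℤ - D) ≡ 1ℤ + G - (A - D)
          l = solve-∀
        lower-top (tri≈ _ t≡a _) = ⊥-elim (ℤₚ.<-irrefl (trans (sym ft≡) (cong f t≡a)) (i-1<i (f a)))
        lower-top (tri> _ _ a<t) = descent-keeping-321 (f a - 1ℤ) a<b b<d desc (fa≢fb+1 ∘ proj₂)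
          (λ (fd≡ₙc , fb≡fd+1) → ℤₚ.<-asym fb<fa (≡ₙ-values-ordered F a<b
            (subst₂ _≡ₙ_ (sym fb≡fd+1) (i-1+1≡i (f a)) (≡ₙ-+ʳ 1ℤ fd≡ₙc))))
          fb<fa fd<fb
          where
          desc : inv (f a - 1ℤ + 1ℤ) < t
          desc = subst (_< t) (sym (trans (cong inv (i-1+1≡i (f a))) (inv-f a))) a<t
      ... | yes fa-1≡fb | no fb-1≢fd = raise-bottom (ℤₚ.<-cmp t d)
        where
        t : ℤ
        t = inv (f d + 1ℤ)
        ft≡ : f t ≡ f d + 1ℤ
        ft≡ = f-inv (f d + 1ℤ)
        fb≢fd+1 : f b ≢ f d + 1ℤ
        fb≢fd+1 fb≡fd+1 = fb-1≢fd (trans (cong (_- 1ℤ) fb≡fd+1) (i+1-1≡i (f d)))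
        raise-bottom : Tri (t < d) (t ≡ d) (d < t) → BraidedReducedWord f
        raise-bottom (tri> _ _ d<t) = 321⇒braided-by-gap gap a b t a<b (ℤₚ.<-trans b<d d<t) fb<fa
          (subst (_< f b) (sym ft≡) (<∧≢⇒+1< fd<fb fb≢fd+1))
          (subst (λ x → f a - x ≤ + gap) (sym ft≡) (≤-by-diff gap-bound (l (f a) (f d) (+ gap))))
          where
          l : ∀ A D G → G - (A - (D + 1ℤ)) ≡ 1ℤ + G - (A - D)
          l = solve-∀
        raise-bottom (tri≈ _ t≡d _) = ⊥-elim (ℤₚ.<-irrefl (trans (cong f (sym t≡d)) ft≡) (i<i+1 (f d)))
        raise-bottom (tri< t<d _ _) = descent-keeping-321 (f d) a<b b<d desc
          (λ (fb≡ₙfd , _) → ℤₚ.<-asym fd<fb (≡ₙ-values-ordered F b<d (≡ₙ-sym fb≡ₙfd)))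
          (fb≢fd+1 ∘ proj₂) fb<fa fd<fb
          where
          desc : t < inv (f d)
          desc = subst (t <_) (sym (inv-f d)) t<d
      ... | yes fa-1≡fb | yes fb-1≡fd = consecutive-braid a b d a<b b<d
        (trans (sym (i-1+1≡i (f a))) (cong (_+ 1ℤ) (trans fa-1≡fb fb≡fd+1))) fb≡fd+1
        where
        fb≡fd+1 : f b ≡ f d + 1ℤ
        fb≡fd+1 = trans (sym (i-1+1≡i (f b))) (cong (_+ 1ℤ) fb-1≡fd)

    321⇒braided : ∀ k {f} → IsPeriodicBijection f → Balanced f → ℓ f ≡ k → Has321 f → BraidedReducedWord f
    321⇒braided k {f} F balanced ℓf≡k (a , b , d , a<b , b<d , fb<fa , fd<fb) =
      321⇒braided-by-gap F balanced after-descent ∣ f a - f d ∣ a b d a<b b<d fb<fa fd<fb gap-bound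
      where
      gap-bound : f a - f d ≤ + ∣ f a - f d ∣
      gap-bound = ℤₚ.≤-reflexive (sym (ℤₚ.0≤i⇒+∣i∣≡i (ℤₚ.<⇒≤ (<⇒0<- (ℤₚ.<-trans fd<fb fb<fa)))))
      after-descent : ∀ c → PB.inv F (c + 1ℤ) < PB.inv F c → Has321 (s c ∘ f) → BraidedReducedWord (s c ∘ f)
      after-descent c desc = shorten k ℓf≡k
        where
        shorter : suc (ℓ (s c ∘ f)) ≡ ℓ f
        shorter = Exchange.descent F c desc
        shorten : ∀ k → ℓ f ≡ k → Has321 (s c ∘ f) → BraidedReducedWord (s c ∘ f)
        shorten zero    ℓf≡0   = ⊥-elim (ℕₚ.1+n≢0 (trans shorter ℓf≡0))
        shorten (suc k) ℓf≡1+k = 321⇒braided k (∘-isPB (s-isPB c) F) (balanced-s∘ F c balanced)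
                                   (ℕₚ.suc-injective (trans shorter ℓf≡1+k))

    reduced-braid⇒321 : ∀ l → IsReducedWord l → ContainsBraid n l → Has321 (eval n l)
    reduced-braid⇒321 l reduced (pre , suf , i , j , refl)
      with braid⇒321 i j suf (reduced-suffix pre (i ∷ j ∷ i ∷ suf) reduced)
    ... | p , q , r , p<q , q<r , fq<fp , fr<fq =
      p , q , r , p<q , q<r , lift p<q fq<fp , lift q<r fr<fq
      where
      lift : ∀ {a b} → a < b → eval n (i ∷ j ∷ i ∷ suf) b < eval n (i ∷ j ∷ i ∷ suf) a →
             eval n l b < eval n l a
      lift = reduced-prefix-preserves-inversion pre (i ∷ j ∷ i ∷ suf) reduced

    module _ (w : AffPerm n) where
      private
        f : ℤ → ℤ
        f = AffPerm.fun w
        F : IsPeriodicBijection f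
        F = affPerm-isPB w

      Reduced⇒IsReducedWord : ∀ l → Reduced n w l → IsReducedWord l
      Reduced⇒IsReducedWord l (expresses , minimal) = ℕₚ.≤-antisym (ℓ-eval≤length l) (begin
        length l                               ≤⟨ minimal (ReducedWord.word r) (ReducedWord.evaluates r) ⟩
        length (ReducedWord.word r)            ≡⟨ ReducedWord.length≡ℓ r ⟩
        ℓ f                                    ≡⟨ ℓ-cong expresses ⟨
        ℓ (eval n l)                           ∎)
        where
        open ℕₚ.≤-Reasoning
        r : ReducedWord f
        r = reduced-word F (AffPerm.sumCond w)

      ReducedWord⇒Reduced : (r : ReducedWord f) → Reduced n w (ReducedWord.word r)
      ReducedWord⇒Reduced r = ReducedWord.evaluates r , λ l expresses → begin
        length (ReducedWord.word r)   ≡⟨ ReducedWord.length≡ℓ r ⟩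
        ℓ f                           ≡⟨ ℓ-cong expresses ⟨
        ℓ (eval n l)                  ≤⟨ ℓ-eval≤length l ⟩
        length l                      ∎
        where open ℕₚ.≤-Reasoning

      avoids321⇒FullyCommutative : ¬ Has321 f → FullyCommutative n w
      avoids321⇒FullyCommutative no321 l reduced braid =
        no321 (Has321-≗ (proj₁ reduced) (reduced-braid⇒321 l (Reduced⇒IsReducedWord l reduced) braid))

      FullyCommutative⇒avoids321 : FullyCommutative n w → ¬ Has321 f
      FullyCommutative⇒avoids321 fc 321-pattern with 321⇒braided (ℓ f) F (AffPerm.sumCond w) refl 321-pattern
      ... | r , braid = fc (ReducedWord.word r) (ReducedWord⇒Reduced r) braid

theorem2p7 : (n : ℕ) .{{_ : NonZero n}} → 3 ℕ.≤ n → (w : AffPerm n) →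
    (FullyCommutative n w ⇔ CondII n w) × (CondII n w ⇔ Avoids321 n w) × (Avoids321 n w ⇔ CondIV n w)
theorem2p7 n 3≤n w =
    mk⇔ (avoids321⇒CondII n w ∘ FullyCommutative⇒avoids321 n 3≤n w)
        (avoids321⇒FullyCommutative n 3≤n w ∘ CondII⇒avoids321 n w)
  , mk⇔ (CondII⇒avoids321 n w) (avoids321⇒CondII n w)
  , mk⇔ (avoids321⇒CondIV n w) (CondIV⇒avoids321 n w)
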